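{- Fix a signature and an inductive definition set $\Phi$. If $\mathrm{Pr}_{+}$ is a $\mathrm{CLKID}^\omega$ proof of $\Gamma\vdash\Delta$, then there exists a $\mathrm{CLKID}^\omega$ proof $\mathrm{Pr}_{+}^{\mathrm{var}}$ of $\Gamma\vdash\Delta$ such that every substitution used in an instance of $(\mathrm{Subst})$ in $\mathrm{Pr}_{+}^{\mathrm{var}}$ is atomic.
   Context: A substitution (finite map from variables to terms) is atomic if its image contains only variables and constant symbols. Language. Terms are built from variables and function symbols of fixed arity. Predicate symbols: equality $=$, ordinary predicate symbols $Q$, inductive predicate symbols $P$. Formulas: $\phi::=P(\vec t)\mid Q(\vec u)\mid t=u\mid\lnot\phi\mid\phi\vee\phi\mid\phi\wedge\phi\mid\phi\to\phi\mid\exists x.\phi\mid\forall x.\phi$, up to $\alpha$-equivalence. An inductive definition set $\Phi$ is a finite set of productions $\dfrac{Q_1(\vec{u_1}(\vec x))\ \cdots\ Q_n(\vec{u_n}(\vec x))\ P_1(\vec{t_1}(\vec x))\ \cdots\ P_m(\vec{t_m}(\vec x))}{P(\vec t(\vec x))}$. Sequents $\Gamma\vdash\Delta$ have finite sets of formulas on each side. Rules of $\mathrm{CLKID}^\omega$: $(\mathrm{Axiom})$: $\Gamma\vdash\Delta$ if $\Gamma\cap\Delta\neq\emptyset$; $(=\mathrm{R})$: $\Gamma\vdash t=t,\Delta$; $(\mathrm{Wk})$; $(\mathrm{Cut})$: from $\Gamma\vdash\phi,\Delta$ and $\Gamma,\phi\vdash\Delta$ infer $\Gamma\vdash\Delta$;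 $(\mathrm{Subst})$: from $\Gamma\vdash\Delta$ infer $\Gamma[\theta]\vdash\Delta[\theta]$ for any substitution $\theta$; standard LK rules for $\lnot,\vee,\wedge,\to$; $(\forall\mathrm{L})$, $(\exists\mathrm{R})$ with arbitrary witness term; $(\forall\mathrm{R})$, $(\exists\mathrm{L})$ with fresh eigenvariable; $(=\mathrm{L})$: from $\Gamma[u/x,t/y]\vdash\Delta[u/x,t/y]$ infer $\Gamma[t/x,u/y],t=u\vdash\Delta[t/x,u/y]$; $(\mathrm{UL})$: from $\Gamma,P(\vec u)\vdash\Delta$ one premise per production of $P$, namely $\Gamma,\vec u=\vec t(\vec y),Q_1(\vec{u_1}(\vec y)),\dots,P_m(\vec{t_m}(\vec y))\vdash\Delta$ with $\vec y$ fresh; $(\mathrm{UR})$: for a production, from $\Gamma\vdash Q_i(\vec{u_i}(\vec u)),\Delta$ and $\Gamma\vdash P_j(\vec{t_j}(\vec u)),\Delta$ for all $i,j$ infer $\Gamma\vdash P(\vec t(\vec u)),\Delta$. A pre-proof is a finite derivation tree whose leaves are axiom instances or buds, each bud assigned a companion (an internal node labelled by the identical sequent). Paths follow conclusion-to-premise edges and bud-to-companion edges. A trace along a path $(e_i)$ is a sequence of occurrences $C_i$ of inductive atoms in the antecedents of $e_i$ where: if $e_i$ is the conclusion of $(\mathrm{UL})$ unfolding $C_i$, then $C_{i+1}$ is an inductive atom introduced by that unfolding and $i$ is a progressing point; otherwise $C_{i+1}$ is the occurrence corresponding to $C_i$. A proof is a pre-proof in which every infinite path has a tail with a trace having infinitely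 many progressing points. -}

module Defs where

open import Data.Nat using (ℕ; zero; suc; _≤_; _+_)
open import Data.Nat.Properties using (_≟_)
open import Data.Fin using (Fin; zero; suc)
open import Data.Vec using (Vec; []; _∷_; toList)
open import Data.List using (List; []; _∷_; _++_; map; length; zipWith; lookup; concat)
open import Data.List.Membership.Propositional using (_∈_; _∉_)
open import Data.List.Relation.Binary.Subset.Propositional using (_⊆_)
open import Data.Product using (Σ; _×_; _,_; proj₁; proj₂)
open import Data.Sum using (_⊎_)
open import Data.Bool using (Bool; true; false)
open import Data.Unit using (⊤; tt)
open import Data.Empty using (⊥)
open import Relation.Binary.PropositionalEquality using (_≡_)
open import Relation.Nullary using (yes; no)

record Sig : Set₁ where
  field
    Fun   : Set
    arF   : Fun → ℕ
    OPred : Set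
    arQ   : OPred → ℕ
    IPred : Set
    arP   : IPred → ℕ

-- set equality of finite sets represented as lists
_≋_ : {A : Set} → List A → List A → Set
xs ≋ ys = (xs ⊆ ys) × (ys ⊆ xs)

module _ (𝕊 : Sig) where
  open Sig 𝕊

  -- Terms and formulas, locally nameless: free variables  var x  (x : ℕ),
  -- bound variables  bv i  as de Bruijn LEVELS (bv zero = outermost binder).
  -- Formulas of  Form 0  are exactly the formulas up to α-equivalence.

  data Term (n : ℕ) : Set where
    var : ℕ → Term n
    bv  : Fin n → Term n
    app : (f : Fun) → Vec (Term n) (arF f) → Term n

  data Form (n : ℕ) : Set where
    ind  : (P : IPred) → Vec (Term n) (arP P) → Form n
    ord  : (Q : OPred) → Vec (Term n) (arQ Q) → Form n
    _≐_  : Term n → Term n → Form n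
    ¬'   : Form n → Form n
    _∨'_ : Form n → Form n → Form n
    _∧'_ : Form n → Form n → Form n
    _⇒'_ : Form n → Form n → Form n
    ∃'   : Form (suc n) → Form n
    ∀'   : Form (suc n) → Form n

  wkT  : ∀ {n} → Term 0 → Term n
  wkTs : ∀ {n k} → Vec (Term 0) k → Vec (Term n) k
  wkT (var x) = var x
  wkT (bv ())
  wkT (app f ts) = app f (wkTs ts)
  wkTs [] = []
  wkTs (t ∷ ts) = wkT t ∷ wkTs ts

  Subst : Set
  Subst = ℕ → Term 0

  FinSupp : Subst → Set
  FinSupp θ = Σ ℕ λ N → ∀ x → N ≤ x → θ x ≡ var x

  sT  : ∀ {n} → Subst → Term n → Term n
  sTs : ∀ {n k} → Subst → Vec (Term n) k → Vec (Term n) k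
  sT θ (var x) = wkT (θ x)
  sT θ (bv i) = bv i
  sT θ (app f ts) = app f (sTs θ ts)
  sTs θ [] = []
  sTs θ (t ∷ ts) = sT θ t ∷ sTs θ ts

  sF : ∀ {n} → Subst → Form n → Form n
  sF θ (ind P ts) = ind P (sTs θ ts)
  sF θ (ord Q ts) = ord Q (sTs θ ts)
  sF θ (t ≐ u) = sT θ t ≐ sT θ u
  sF θ (¬' φ) = ¬' (sF θ φ)
  sF θ (φ ∨' ψ) = sF θ φ ∨' sF θ ψ
  sF θ (φ ∧' ψ) = sF θ φ ∧' sF θ ψ
  sF θ (φ ⇒' ψ) = sF θ φ ⇒' sF θ ψ
  sF θ (∃' φ) = ∃' (sF θ φ)
  sF θ (∀' φ) = ∀' (sF θ φ)

  data AtomicTerm : Term 0 → Set where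
    isVar   : ∀ x → AtomicTerm (var x)
    isConst : ∀ f ts → arF f ≡ 0 → AtomicTerm (app f ts)

  AtomicSubst : Subst → Set
  AtomicSubst θ = ∀ x → AtomicTerm (θ x)

  [_/_,_/_] : Term 0 → ℕ → Term 0 → ℕ → Subst
  [ t / x , u / y ] z with z ≟ x
  ... | yes _ = t
  ... | no _ with z ≟ y
  ...   | yes _ = u
  ...   | no _ = var z

  oT  : ∀ {n} → Term 0 → Term (suc n) → Term n
  oTs : ∀ {n k} → Term 0 → Vec (Term (suc n)) k → Vec (Term n) k
  oT t (var x) = var x
  oT t (bv zero) = wkT t
  oT t (bv (suc i)) = bv i
  oT t (app f ts) = app f (oTs t ts)
  oTs t [] = []
  oTs t (u ∷ us) = oT t u ∷ oTs t us

  oF : ∀ {n} → Term 0 → Form (suc n) → Form n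
  oF t (ind P ts) = ind P (oTs t ts)
  oF t (ord Q ts) = ord Q (oTs t ts)
  oF t (a ≐ b) = oT t a ≐ oT t b
  oF t (¬' φ) = ¬' (oF t φ)
  oF t (φ ∨' ψ) = oF t φ ∨' oF t ψ
  oF t (φ ∧' ψ) = oF t φ ∧' oF t ψ
  oF t (φ ⇒' ψ) = oF t φ ⇒' oF t ψ
  oF t (∃' φ) = ∃' (oF t φ)
  oF t (∀' φ) = ∀' (oF t φ)

  _[_] : Form 1 → Term 0 → Form 0
  φ [ t ] = oF t φ

  fvT  : ∀ {n} → Term n → List ℕ
  fvTs : ∀ {n k} → Vec (Term n) k → List ℕ
  fvT (var x) = x ∷ []
  fvT (bv i) = []
  fvT (app f ts) = fvTs ts
  fvTs [] = []
  fvTs (t ∷ ts) = fvT t ++ fvTs ts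

  fvF : ∀ {n} → Form n → List ℕ
  fvF (ind P ts) = fvTs ts
  fvF (ord Q ts) = fvTs ts
  fvF (t ≐ u) = fvT t ++ fvT u
  fvF (¬' φ) = fvF φ
  fvF (φ ∨' ψ) = fvF φ ++ fvF ψ
  fvF (φ ∧' ψ) = fvF φ ++ fvF ψ
  fvF (φ ⇒' ψ) = fvF φ ++ fvF ψ
  fvF (∃' φ) = fvF φ
  fvF (∀' φ) = fvF φ

  fvL : List (Form 0) → List ℕ
  fvL [] = []
  fvL (φ ∷ φs) = fvF φ ++ fvL φs

  IsIndAtom : Form 0 → Set
  IsIndAtom φ = Σ IPred λ P → Σ (Vec (Term 0) (arP P)) λ us → φ ≡ ind P us

  -- Sequents: finite SETS of formulas, represented by lists up to _≋_

  record Seq : Set where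
    constructor _⊢_
    field
      ante : List (Form 0)
      succ : List (Form 0)
  open Seq public

  _≈S_ : Seq → Seq → Set
  S ≈S S' = (ante S ≋ ante S') × (succ S ≋ succ S')

  fvSeq : Seq → List ℕ
  fvSeq S = fvL (ante S) ++ fvL (succ S)

  -- Productions  Q₁(u₁(x)) … Qₙ(uₙ(x)) P₁(t₁(x)) … Pₘ(tₘ(x)) / P(t(x))
  -- (the variables x are the free variables occurring in the production)

  record Production : Set where
    field
      head     : IPred
      headArgs : Vec (Term 0) (arP head)
      ordPrems : List (Σ OPred λ Q → Vec (Term 0) (arQ Q))
      indPrems : List (Σ IPred λ P → Vec (Term 0) (arP P))
  open Production public

  ordFs : Production → Subst → List (Form 0)
  ordFs π θ = map (λ q → ord (proj₁ q) (sTs θ (proj₂ q))) (ordPrems π)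

  indFs : Production → Subst → List (Form 0)
  indFs π θ = map (λ p → ind (proj₁ p) (sTs θ (proj₂ p))) (indPrems π)

  fvProd : Production → List ℕ
  fvProd π = fvTs (headArgs π)
          ++ concat (map (λ q → fvTs (proj₂ q)) (ordPrems π))
          ++ concat (map (λ p → fvTs (proj₂ p)) (indPrems π))

  FreshRen : Seq → Production → (ℕ → ℕ) → Set
  FreshRen S π ρ =
    (∀ x y → x ∈ fvProd π → y ∈ fvProd π → ρ x ≡ ρ y → x ≡ y)
    × (∀ x → x ∈ fvProd π → ρ x ∉ fvSeq S)

  renS : (ℕ → ℕ) → Subst
  renS ρ x = var (ρ x)

  unfoldAnte : Production → (ℕ → ℕ) → List (Term 0) → List (Form 0)
  unfoldAnte π ρ us =
    zipWith _≐_ us (toList (sTs (renS ρ) (headArgs π)))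
    ++ ordFs π (renS ρ) ++ indFs π (renS ρ)

  module _ (Φ : List Production) where

    -- rules of the shape:  premises  (Γ', Γ ⊢ Δ', Δ)  /  conclusion  (Γ'', Γ ⊢ Δ'', Δ)
    -- with the side context Γ ⊢ Δ carried along unchanged
    data LKRule : Set where
      axR  : Form 0 → LKRule
      eqR  : Term 0 → LKRule
      wkR  : List (Form 0) → List (Form 0) → LKRule
      cutR : Form 0 → LKRule
      negL negR : Form 0 → LKRule
      orL orR andL andR impL impR : Form 0 → Form 0 → LKRule
      allL exR : Form 1 → Term 0 → LKRule
      allR exL : Form 1 → ℕ → LKRule
      urR  : (π : Production) → π ∈ Φ → Subst → LKRule

    prFs : Production → Subst → List (Form 0)
    prFs π θ = ordFs π θ ++ indFs π θ

    concExtra : LKRule → List (Form 0) × List (Form 0)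
    concExtra (axR φ) = φ ∷ [] , φ ∷ []
    concExtra (eqR t) = [] , (t ≐ t) ∷ []
    concExtra (wkR Γ' Δ') = Γ' , Δ'
    concExtra (cutR φ) = [] , []
    concExtra (negL φ) = ¬' φ ∷ [] , []
    concExtra (negR φ) = [] , ¬' φ ∷ []
    concExtra (orL φ ψ) = (φ ∨' ψ) ∷ [] , []
    concExtra (orR φ ψ) = [] , (φ ∨' ψ) ∷ []
    concExtra (andL φ ψ) = (φ ∧' ψ) ∷ [] , []
    concExtra (andR φ ψ) = [] , (φ ∧' ψ) ∷ []
    concExtra (impL φ ψ) = (φ ⇒' ψ) ∷ [] , []
    concExtra (impR φ ψ) = [] , (φ ⇒' ψ) ∷ []
    concExtra (allL φ t) = ∀' φ ∷ [] , []
    concExtra (exR φ t) = [] , ∃' φ ∷ []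
    concExtra (allR φ x) = [] , ∀' φ ∷ []
    concExtra (exL φ x) = ∃' φ ∷ [] , []
    concExtra (urR π _ θ) = [] , ind (head π) (sTs θ (headArgs π)) ∷ []

    nPrem : LKRule → ℕ
    nPrem (axR _) = 0
    nPrem (eqR _) = 0
    nPrem (wkR _ _) = 1
    nPrem (cutR _) = 2
    nPrem (negL _) = 1
    nPrem (negR _) = 1
    nPrem (orL _ _) = 2
    nPrem (orR _ _) = 1
    nPrem (andL _ _) = 1
    nPrem (andR _ _) = 2
    nPrem (impL _ _) = 2
    nPrem (impR _ _) = 1
    nPrem (allL _ _) = 1
    nPrem (exR _ _) = 1
    nPrem (allR _ _) = 1
    nPrem (exL _ _) = 1
    nPrem (urR π _ θ) = length (prFs π θ)

    premExtra : (R : LKRule) → Fin (nPrem R) → List (Form 0) × List (Form 0)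
    premExtra (axR _) ()
    premExtra (eqR _) ()
    premExtra (wkR _ _) _ = [] , []
    premExtra (cutR φ) zero = [] , φ ∷ []
    premExtra (cutR φ) (suc _) = φ ∷ [] , []
    premExtra (negL φ) _ = [] , φ ∷ []
    premExtra (negR φ) _ = φ ∷ [] , []
    premExtra (orL φ ψ) zero = φ ∷ [] , []
    premExtra (orL φ ψ) (suc _) = ψ ∷ [] , []
    premExtra (orR φ ψ) _ = [] , φ ∷ ψ ∷ []
    premExtra (andL φ ψ) _ = φ ∷ ψ ∷ [] , []
    premExtra (andR φ ψ) zero = [] , φ ∷ []
    premExtra (andR φ ψ) (suc _) = [] , ψ ∷ []
    premExtra (impL φ ψ) zero = [] , φ ∷ []
    premExtra (impL φ ψ) (suc _) = ψ ∷ [] , []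
    premExtra (impR φ ψ) _ = φ ∷ [] , ψ ∷ []
    premExtra (allL φ t) _ = (φ [ t ]) ∷ [] , []
    premExtra (exR φ t) _ = [] , (φ [ t ]) ∷ []
    premExtra (allR φ x) _ = [] , (φ [ var x ]) ∷ []
    premExtra (exL φ x) _ = (φ [ var x ]) ∷ [] , []
    premExtra (urR π _ θ) i = [] , lookup (prFs π θ) i ∷ []

    side : LKRule → Seq → Set
    side (allR φ x) S = x ∉ fvSeq S
    side (exL φ x) S = x ∉ fvSeq S
    side _ S = ⊤

    data Inst (S : Seq) : Set where
      lk    : (R : LKRule) (Γ Δ : List (Form 0)) → side R S
            → ante S ≋ (proj₁ (concExtra R) ++ Γ)
            → succ S ≋ (proj₂ (concExtra R) ++ Δ) → Inst S
      substI : (θ : Subst) → FinSupp θ → (Γ Δ : List (Form 0))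
            → ante S ≋ map (sF θ) Γ → succ S ≋ map (sF θ) Δ → Inst S
      -- (=L): from Γ[u/x,t/y] ⊢ Δ[u/x,t/y] infer Γ[t/x,u/y], t = u ⊢ Δ[t/x,u/y]
      eqLI  : (t u : Term 0) (x y : ℕ) (Γ Δ : List (Form 0))
            → ante S ≋ ((t ≐ u) ∷ map (sF [ t / x , u / y ]) Γ)
            → succ S ≋ map (sF [ t / x , u / y ]) Δ → Inst S
      -- (UL) on P(us): one premise per production of P in Φ, with fresh variables
      ulI   : (P : IPred) (us : Vec (Term 0) (arP P)) (Γ Δ : List (Form 0))
            → ante S ≋ (ind P us ∷ Γ) → succ S ≋ Δ
            → (ρ : Fin (length Φ) → ℕ → ℕ)
            → (∀ i → head (lookup Φ i) ≡ P → FreshRen S (lookup Φ i) (ρ i))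
            → Inst S

    Prem : ∀ {S} → Inst S → Set
    Prem (lk R _ _ _ _ _) = Fin (nPrem R)
    Prem (substI _ _ _ _ _ _) = ⊤
    Prem (eqLI _ _ _ _ _ _ _ _) = ⊤
    Prem (ulI P _ _ _ _ _ _ _) = Σ (Fin (length Φ)) λ i → head (lookup Φ i) ≡ P

    premSeq : ∀ {S} (r : Inst S) → Prem r → Seq
    premSeq (lk R Γ Δ _ _ _) i =
      (proj₁ (premExtra R i) ++ Γ) ⊢ (proj₂ (premExtra R i) ++ Δ)
    premSeq (substI θ _ Γ Δ _ _) _ = Γ ⊢ Δ
    premSeq (eqLI t u x y Γ Δ _ _) _ =
      map (sF [ u / x , t / y ]) Γ ⊢ map (sF [ u / x , t / y ]) Δ
    premSeq (ulI P us Γ Δ _ _ ρ _) (i , _) =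
      (unfoldAnte (lookup Φ i) (ρ i) (toList us) ++ Γ) ⊢ Δ

    -- trace pairs: (C in conclusion, C' in premise, progressing?)
    Step : ∀ {S} (r : Inst S) → Prem r → Form 0 → Form 0 → Bool → Set
    Step (lk R Γ Δ _ _ _) _ C C' b = (C ∈ Γ) × (C' ≡ C) × (b ≡ false)
    Step (substI θ _ Γ Δ _ _) _ C C' b = (C' ∈ Γ) × (C ≡ sF θ C') × (b ≡ false)
    Step (eqLI t u x y Γ Δ _ _) _ C C' b =
      Σ (Form 0) λ C₀ → (C₀ ∈ Γ) × (C ≡ sF [ t / x , u / y ] C₀)
                        × (C' ≡ sF [ u / x , t / y ] C₀) × (b ≡ false)
    Step (ulI P us Γ Δ _ _ ρ _) (i , _) C C' b =
      ((C ∈ Γ) × (C' ≡ C) × (b ≡ false))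
      ⊎ ((C ≡ ind P us) × (C' ∈ indFs (lookup Φ i) (renS (ρ i))) × (b ≡ true))

    substAtomic : ∀ {S} → Inst S → Set
    substAtomic (substI θ _ _ _ _ _) = AtomicSubst θ
    substAtomic _ = ⊤

    data PTree : Set where
      bud  : Seq → PTree
      node : (S : Seq) (r : Inst S) → (Prem r → PTree) → PTree

    seqOf : PTree → Seq
    seqOf (bud S) = S
    seqOf (node S _ _) = S

    Valid : PTree → Set
    Valid (bud _) = ⊤
    Valid (node S r ch) = ∀ p → (seqOf (ch p) ≈S premSeq r p) × Valid (ch p)

    IsBud : PTree → Set
    IsBud (bud _) = ⊤
    IsBud (node _ _ _) = ⊥

    IsNode : PTree → Set
    IsNode (bud _) = ⊥
    IsNode (node _ _ _) = ⊤

    AllSubstAtomic : PTree → Set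
    AllSubstAtomic (bud _) = ⊤
    AllSubstAtomic (node S r ch) = substAtomic r × (∀ p → AllSubstAtomic (ch p))

    data Addr : PTree → Set where
      here  : ∀ {t} → Addr t
      there : ∀ {S r ch} (p : Prem r) → Addr (ch p) → Addr (node S r ch)

    at : (t : PTree) → Addr t → PTree
    at t here = t
    at (node S r ch) (there p a) = at (ch p) a

    data Child : (t : PTree) → Addr t → Addr t → Set where
      top  : ∀ {S r ch} (p : Prem r) → Child (node S r ch) here (there p here)
      down : ∀ {S r ch} (p : Prem r) {a a'} → Child (ch p) a a'
           → Child (node S r ch) (there p a) (there p a')

    childStep : ∀ {t a a'} → Child t a a' → Form 0 → Form 0 → Bool → Set
    childStep (top {r = r} p) = Step r p
    childStep (down p c) = childStep c

    record PreProof (goal : Seq) : Set where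
      field
        tree     : PTree
        valid    : Valid tree
        rootSeq  : seqOf tree ≈S goal
        comp     : (a : Addr tree) → IsBud (at tree a) → Addr tree
        compNode : ∀ a b → IsNode (at tree (comp a b))
        compSeq  : ∀ a b → seqOf (at tree (comp a b)) ≈S seqOf (at tree a)

    module _ {goal : Seq} (pp : PreProof goal) where
      open PreProof pp

      data Edge : Addr tree → Addr tree → Set where
        child : ∀ {a a'} → Child tree a a' → Edge a a'
        back  : ∀ {a} (b : IsBud (at tree a)) → Edge a (comp a b)

      edgeStep : ∀ {a a'} → Edge a a' → Form 0 → Form 0 → Bool → Set
      edgeStep (child c) = childStep c
      edgeStep (back _) C C' b = (C' ≡ C) × (b ≡ false)

      TraceFrom : (ν : ℕ → Addr tree) → (∀ n → Edge (ν n) (ν (suc n))) → ℕ → Set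
      TraceFrom ν e i₀ =
        Σ (ℕ → Form 0) λ τ → Σ (ℕ → Bool) λ prog →
          (∀ n → IsIndAtom (τ n) × (τ n ∈ ante (seqOf (at tree (ν (n + i₀))))))
          × (∀ n → edgeStep (e (n + i₀)) (τ n) (τ (suc n)) (prog n))
          × (∀ m → Σ ℕ λ n → (m ≤ n) × (prog n ≡ true))

      GlobalTrace : Set
      GlobalTrace = (ν : ℕ → Addr tree) (e : ∀ n → Edge (ν n) (ν (suc n)))
                  → Σ ℕ λ i₀ → TraceFrom ν e i₀

    record Proof (goal : Seq) : Set where
      field
        preproof : PreProof goal
        gtc      : GlobalTrace preproof

    AtomicSubstProof : ∀ {goal} → Proof goal → Set
    AtomicSubstProof pr = AllSubstAtomic (PreProof.tree (Proof.preproof pr))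

-- Γθ ⊢ Δθ is reached from Γ ⊢ Δ by atomic substitutions and first-order rules alone. Pick M above
-- every variable of Γ, Δ and θ 0, …, θ (N-1), where θ is the identity from N on. Then θ agrees on Γ, Δ
-- with the renaming x ↦ M + x (x < N) followed by the single substitutions [θ k / M + k], and each of
-- these is simulated below the renamed sequent by a cut on ∃z. θ k = z: its left premise is closed by
-- (∃R) with witness θ k and (=R), its right premise introduces the fresh variable M + k by (∃L) and
-- replaces it by θ k with (=L). Every edge of the new pre-proof either copies an edge of the old one or
-- stays at the premise of the replaced (Subst) while a rank decreases, and inductive atoms are carried
-- along. Buds and companions are unchanged, so every infinite path of the new pre-proof projects to one
-- of the old, whose progressing trace lifts back.

module Submission where

open import Defs
open import Data.Nat using (ℕ; zero; suc; _+_; _<_; _≤_; s≤s; z≤n)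
open import Data.Nat.Properties
  using (_≟_; _<?_; <-irrefl; <-≤-trans; ≤-trans; ≤-refl; <⇒≤; n≤1+n; m≤m+n; m≤n+m; ≤⇒≯; ≮⇒≥; +-cancelˡ-≡;
         ≤-antisym; ≤-pred; +-suc; +-comm; m≤n⇒m<n∨m≡n; m≤n⇒∃[o]m+o≡n)
open import Data.Fin using (Fin; zero; suc)
open import Data.Vec using (Vec; []; _∷_)
open import Data.List using (List; []; _∷_; _++_; map; concat; applyUpTo)
open import Data.List.Extrema.Nat using (max; xs≤max)
open import Data.List.Membership.Propositional using (_∈_; _∉_)
open import Data.List.Membership.Propositional.Properties
  using (∈-++⁺ˡ; ∈-++⁺ʳ; ∈-++⁻; ∈-map⁺; ∈-concat⁺′; ∈-applyUpTo⁺)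
open import Data.List.Properties using (map-∘; map-cong-local; map-id-local)
open import Data.List.Relation.Binary.Subset.Propositional.Properties using (⊆-reflexive; ⊆-trans)
open import Data.List.Relation.Unary.All as All using (All)
open import Data.List.Relation.Unary.Any using (here; there)
open import Data.Product using (Σ; _×_; _,_; proj₁; proj₂)
open import Data.Sum using (inj₁; inj₂)
open import Data.Bool using (Bool; true; false)
open import Data.Unit using (⊤; tt)
open import Data.Empty using (⊥-elim)
open import Relation.Nullary using (yes; no; ¬_)
open import Relation.Binary.PropositionalEquality

≋-reflexive : {A : Set} {xs ys : List A} → xs ≡ ys → xs ≋ ys
≋-reflexive xs≡ys = ⊆-reflexive xs≡ys , ⊆-reflexive (sym xs≡ys)

≋-refl : {A : Set} {xs : List A} → xs ≋ xs
≋-refl = ≋-reflexive refl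

≋-trans : {A : Set} {xs ys zs : List A} → xs ≋ ys → ys ≋ zs → xs ≋ zs
≋-trans (xs⊆ys , ys⊆xs) (ys⊆zs , zs⊆ys) = ⊆-trans xs⊆ys ys⊆zs , ⊆-trans zs⊆ys ys⊆xs

module Syntax (𝕊 : Sig) where
  _⊙_ : Subst 𝕊 → Subst 𝕊 → Subst 𝕊
  (σ ⊙ θ) x = sT 𝕊 σ (θ x)

  IsIdentity : Subst 𝕊 → Set
  IsIdentity θ = ∀ x → θ x ≡ var x

  AgreeOn : List ℕ → Subst 𝕊 → Subst 𝕊 → Set
  AgreeOn xs θ θ′ = ∀ x → x ∈ xs → θ x ≡ θ′ x

  wkT-closed : (t : Term 𝕊 0) → wkT 𝕊 t ≡ t
  wkTs-closed : ∀ {k} (ts : Vec (Term 𝕊 0) k) → wkTs 𝕊 ts ≡ ts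
  wkT-closed (var x) = refl
  wkT-closed (app f ts) = cong (app f) (wkTs-closed ts)
  wkTs-closed [] = refl
  wkTs-closed (t ∷ ts) = cong₂ _∷_ (wkT-closed t) (wkTs-closed ts)

  oT-wkT : (s t : Term 𝕊 0) → oT 𝕊 s (wkT 𝕊 t) ≡ t
  oTs-wkTs : ∀ {k} (s : Term 𝕊 0) (ts : Vec (Term 𝕊 0) k) → oTs 𝕊 s (wkTs 𝕊 ts) ≡ ts
  oT-wkT s (var x) = refl
  oT-wkT s (app f ts) = cong (app f) (oTs-wkTs s ts)
  oTs-wkTs s [] = refl
  oTs-wkTs s (t ∷ ts) = cong₂ _∷_ (oT-wkT s t) (oTs-wkTs s ts)

  fvT-wkT : ∀ {n} (t : Term 𝕊 0) → fvT 𝕊 (wkT 𝕊 {n} t) ≡ fvT 𝕊 t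
  fvTs-wkTs : ∀ {n k} (ts : Vec (Term 𝕊 0) k) → fvTs 𝕊 (wkTs 𝕊 {n} ts) ≡ fvTs 𝕊 ts
  fvT-wkT (var x) = refl
  fvT-wkT (app f ts) = fvTs-wkTs ts
  fvTs-wkTs [] = refl
  fvTs-wkTs (t ∷ ts) = cong₂ _++_ (fvT-wkT t) (fvTs-wkTs ts)

  sT-wkT : ∀ {n} σ (t : Term 𝕊 0) → sT 𝕊 σ (wkT 𝕊 {n} t) ≡ wkT 𝕊 (sT 𝕊 σ t)
  sTs-wkTs : ∀ {n k} σ (ts : Vec (Term 𝕊 0) k) → sTs 𝕊 σ (wkTs 𝕊 {n} ts) ≡ wkTs 𝕊 (sTs 𝕊 σ ts)
  sT-wkT σ (var x) = sym (cong (wkT 𝕊) (wkT-closed (σ x)))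
  sT-wkT σ (app f ts) = cong (app f) (sTs-wkTs σ ts)
  sTs-wkTs σ [] = refl
  sTs-wkTs σ (t ∷ ts) = cong₂ _∷_ (sT-wkT σ t) (sTs-wkTs σ ts)

  sT-⊙ : ∀ {n} σ θ (t : Term 𝕊 n) → sT 𝕊 σ (sT 𝕊 θ t) ≡ sT 𝕊 (σ ⊙ θ) t
  sTs-⊙ : ∀ {n k} σ θ (ts : Vec (Term 𝕊 n) k) → sTs 𝕊 σ (sTs 𝕊 θ ts) ≡ sTs 𝕊 (σ ⊙ θ) ts
  sT-⊙ σ θ (var x) = sT-wkT σ (θ x)
  sT-⊙ σ θ (bv i) = refl
  sT-⊙ σ θ (app f ts) = cong (app f) (sTs-⊙ σ θ ts)
  sTs-⊙ σ θ [] = refl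
  sTs-⊙ σ θ (t ∷ ts) = cong₂ _∷_ (sT-⊙ σ θ t) (sTs-⊙ σ θ ts)

  sF-⊙ : ∀ {n} σ θ (φ : Form 𝕊 n) → sF 𝕊 σ (sF 𝕊 θ φ) ≡ sF 𝕊 (σ ⊙ θ) φ
  sF-⊙ σ θ (ind P ts) = cong (ind P) (sTs-⊙ σ θ ts)
  sF-⊙ σ θ (ord Q ts) = cong (ord Q) (sTs-⊙ σ θ ts)
  sF-⊙ σ θ (t ≐ u) = cong₂ _≐_ (sT-⊙ σ θ t) (sT-⊙ σ θ u)
  sF-⊙ σ θ (¬' φ) = cong ¬' (sF-⊙ σ θ φ)
  sF-⊙ σ θ (φ ∨' ψ) = cong₂ _∨'_ (sF-⊙ σ θ φ) (sF-⊙ σ θ ψ)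
  sF-⊙ σ θ (φ ∧' ψ) = cong₂ _∧'_ (sF-⊙ σ θ φ) (sF-⊙ σ θ ψ)
  sF-⊙ σ θ (φ ⇒' ψ) = cong₂ _⇒'_ (sF-⊙ σ θ φ) (sF-⊙ σ θ ψ)
  sF-⊙ σ θ (∃' φ) = cong ∃' (sF-⊙ σ θ φ)
  sF-⊙ σ θ (∀' φ) = cong ∀' (sF-⊙ σ θ φ)

  private
    agreeˡ : ∀ xs {ys θ θ′} → AgreeOn (xs ++ ys) θ θ′ → AgreeOn xs θ θ′
    agreeˡ xs h x m = h x (∈-++⁺ˡ m)

    agreeʳ : ∀ xs {ys θ θ′} → AgreeOn (xs ++ ys) θ θ′ → AgreeOn ys θ θ′
    agreeʳ xs h x m = h x (∈-++⁺ʳ xs m)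

  sT-cong-fv : ∀ {n} θ θ′ (t : Term 𝕊 n) → AgreeOn (fvT 𝕊 t) θ θ′ → sT 𝕊 θ t ≡ sT 𝕊 θ′ t
  sTs-cong-fv : ∀ {n k} θ θ′ (ts : Vec (Term 𝕊 n) k) → AgreeOn (fvTs 𝕊 ts) θ θ′ → sTs 𝕊 θ ts ≡ sTs 𝕊 θ′ ts
  sT-cong-fv θ θ′ (var x) h = cong (wkT 𝕊) (h x (here refl))
  sT-cong-fv θ θ′ (bv i) h = refl
  sT-cong-fv θ θ′ (app f ts) h = cong (app f) (sTs-cong-fv θ θ′ ts h)
  sTs-cong-fv θ θ′ [] h = refl
  sTs-cong-fv θ θ′ (t ∷ ts) h =
    cong₂ _∷_ (sT-cong-fv θ θ′ t (agreeˡ (fvT 𝕊 t) h)) (sTs-cong-fv θ θ′ ts (agreeʳ (fvT 𝕊 t) h))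

  sF-cong-fv : ∀ {n} θ θ′ (φ : Form 𝕊 n) → AgreeOn (fvF 𝕊 φ) θ θ′ → sF 𝕊 θ φ ≡ sF 𝕊 θ′ φ
  sF-cong-fv θ θ′ (ind P ts) h = cong (ind P) (sTs-cong-fv θ θ′ ts h)
  sF-cong-fv θ θ′ (ord Q ts) h = cong (ord Q) (sTs-cong-fv θ θ′ ts h)
  sF-cong-fv θ θ′ (t ≐ u) h =
    cong₂ _≐_ (sT-cong-fv θ θ′ t (agreeˡ (fvT 𝕊 t) h)) (sT-cong-fv θ θ′ u (agreeʳ (fvT 𝕊 t) h))
  sF-cong-fv θ θ′ (¬' φ) h = cong ¬' (sF-cong-fv θ θ′ φ h)
  sF-cong-fv θ θ′ (φ ∨' ψ) h =
    cong₂ _∨'_ (sF-cong-fv θ θ′ φ (agreeˡ (fvF 𝕊 φ) h)) (sF-cong-fv θ θ′ ψ (agreeʳ (fvF 𝕊 φ) h))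
  sF-cong-fv θ θ′ (φ ∧' ψ) h =
    cong₂ _∧'_ (sF-cong-fv θ θ′ φ (agreeˡ (fvF 𝕊 φ) h)) (sF-cong-fv θ θ′ ψ (agreeʳ (fvF 𝕊 φ) h))
  sF-cong-fv θ θ′ (φ ⇒' ψ) h =
    cong₂ _⇒'_ (sF-cong-fv θ θ′ φ (agreeˡ (fvF 𝕊 φ) h)) (sF-cong-fv θ θ′ ψ (agreeʳ (fvF 𝕊 φ) h))
  sF-cong-fv θ θ′ (∃' φ) h = cong ∃' (sF-cong-fv θ θ′ φ h)
  sF-cong-fv θ θ′ (∀' φ) h = cong ∀' (sF-cong-fv θ θ′ φ h)

  sT-var : ∀ {n} (t : Term 𝕊 n) → sT 𝕊 var t ≡ t
  sTs-var : ∀ {n k} (ts : Vec (Term 𝕊 n) k) → sTs 𝕊 var ts ≡ ts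
  sT-var (var x) = refl
  sT-var (bv i) = refl
  sT-var (app f ts) = cong (app f) (sTs-var ts)
  sTs-var [] = refl
  sTs-var (t ∷ ts) = cong₂ _∷_ (sT-var t) (sTs-var ts)

  sF-var : ∀ {n} (φ : Form 𝕊 n) → sF 𝕊 var φ ≡ φ
  sF-var (ind P ts) = cong (ind P) (sTs-var ts)
  sF-var (ord Q ts) = cong (ord Q) (sTs-var ts)
  sF-var (t ≐ u) = cong₂ _≐_ (sT-var t) (sT-var u)
  sF-var (¬' φ) = cong ¬' (sF-var φ)
  sF-var (φ ∨' ψ) = cong₂ _∨'_ (sF-var φ) (sF-var ψ)
  sF-var (φ ∧' ψ) = cong₂ _∧'_ (sF-var φ) (sF-var ψ)
  sF-var (φ ⇒' ψ) = cong₂ _⇒'_ (sF-var φ) (sF-var ψ)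
  sF-var (∃' φ) = cong ∃' (sF-var φ)
  sF-var (∀' φ) = cong ∀' (sF-var φ)

  sF-identity : ∀ {n} θ → IsIdentity θ → (φ : Form 𝕊 n) → sF 𝕊 θ φ ≡ φ
  sF-identity θ id φ = trans (sF-cong-fv θ var φ (λ x _ → id x)) (sF-var φ)

  sF-indAtom : ∀ θ {φ} → IsIndAtom 𝕊 φ → IsIndAtom 𝕊 (sF 𝕊 θ φ)
  sF-indAtom θ (P , us , refl) = P , sTs 𝕊 θ us , refl

  InImage : Subst 𝕊 → List ℕ → ℕ → Set
  InImage θ xs x = Σ ℕ λ y → (y ∈ xs) × (x ∈ fvT 𝕊 (θ y))

  private
    inImage-++ : ∀ {θ} xs ys {as bs x}
               → (x ∈ as → InImage θ xs x) → (x ∈ bs → InImage θ ys x)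
               → x ∈ as ++ bs → InImage θ (xs ++ ys) x
    inImage-++ xs ys {as} f g m with ∈-++⁻ as m
    ... | inj₁ m′ = let y , y∈ , x∈ = f m′ in y , ∈-++⁺ˡ y∈ , x∈
    ... | inj₂ m′ = let y , y∈ , x∈ = g m′ in y , ∈-++⁺ʳ xs y∈ , x∈

  fvT-sT⁻ : ∀ {n} θ (t : Term 𝕊 n) {x} → x ∈ fvT 𝕊 (sT 𝕊 θ t) → InImage θ (fvT 𝕊 t) x
  fvTs-sTs⁻ : ∀ {n k} θ (ts : Vec (Term 𝕊 n) k) {x} → x ∈ fvTs 𝕊 (sTs 𝕊 θ ts) → InImage θ (fvTs 𝕊 ts) x
  fvT-sT⁻ θ (var y) m = y , here refl , subst (_ ∈_) (fvT-wkT (θ y)) m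
  fvT-sT⁻ θ (app f ts) m = fvTs-sTs⁻ θ ts m
  fvTs-sTs⁻ θ (t ∷ ts) = inImage-++ {θ} (fvT 𝕊 t) (fvTs 𝕊 ts) (fvT-sT⁻ θ t) (fvTs-sTs⁻ θ ts)

  fvF-sF⁻ : ∀ {n} θ (φ : Form 𝕊 n) {x} → x ∈ fvF 𝕊 (sF 𝕊 θ φ) → InImage θ (fvF 𝕊 φ) x
  fvF-sF⁻ θ (ind P ts) = fvTs-sTs⁻ θ ts
  fvF-sF⁻ θ (ord Q ts) = fvTs-sTs⁻ θ ts
  fvF-sF⁻ θ (t ≐ u) = inImage-++ {θ} (fvT 𝕊 t) (fvT 𝕊 u) (fvT-sT⁻ θ t) (fvT-sT⁻ θ u)
  fvF-sF⁻ θ (¬' φ) = fvF-sF⁻ θ φ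
  fvF-sF⁻ θ (φ ∨' ψ) = inImage-++ {θ} (fvF 𝕊 φ) (fvF 𝕊 ψ) (fvF-sF⁻ θ φ) (fvF-sF⁻ θ ψ)
  fvF-sF⁻ θ (φ ∧' ψ) = inImage-++ {θ} (fvF 𝕊 φ) (fvF 𝕊 ψ) (fvF-sF⁻ θ φ) (fvF-sF⁻ θ ψ)
  fvF-sF⁻ θ (φ ⇒' ψ) = inImage-++ {θ} (fvF 𝕊 φ) (fvF 𝕊 ψ) (fvF-sF⁻ θ φ) (fvF-sF⁻ θ ψ)
  fvF-sF⁻ θ (∃' φ) = fvF-sF⁻ θ φ
  fvF-sF⁻ θ (∀' φ) = fvF-sF⁻ θ φ

  fvF⊆fvL : ∀ {φ x} (φs : List (Form 𝕊 0)) → φ ∈ φs → x ∈ fvF 𝕊 φ → x ∈ fvL 𝕊 φs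
  fvF⊆fvL (φ ∷ φs) (here refl) m = ∈-++⁺ˡ m
  fvF⊆fvL (ψ ∷ φs) (there p) m = ∈-++⁺ʳ (fvF 𝕊 ψ) (fvF⊆fvL φs p m)

  fvL-map-sF⁻ : ∀ σ (φs : List (Form 𝕊 0)) {x} → x ∈ fvL 𝕊 (map (sF 𝕊 σ) φs) → InImage σ (fvL 𝕊 φs) x
  fvL-map-sF⁻ σ (φ ∷ φs) = inImage-++ {σ} (fvF 𝕊 φ) (fvL 𝕊 φs) (fvF-sF⁻ σ φ) (fvL-map-sF⁻ σ φs)

  [/,/]-first : ∀ t x u y → [_/_,_/_] 𝕊 t x u y x ≡ t
  [/,/]-first t x u y with x ≟ x
  ... | yes _ = refl
  ... | no x≢x = ⊥-elim (x≢x refl)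

  [/,/]-other : ∀ t x u {z} → z ≢ x → [_/_,_/_] 𝕊 t x u x z ≡ var z
  [/,/]-other t x u {z} z≢x with z ≟ x
  ... | yes z≡x = ⊥-elim (z≢x z≡x)
  ... | no _ with z ≟ x
  ...   | yes z≡x = ⊥-elim (z≢x z≡x)
  ...   | no _ = refl

  [x/x,/x]-identity : ∀ x t → IsIdentity ([_/_,_/_] 𝕊 (var x) x t x)
  [x/x,/x]-identity x t z with z ≟ x
  ... | yes z≡x = cong var (sym z≡x)
  ... | no z≢x with z ≟ x
  ...   | yes z≡x = ⊥-elim (z≢x z≡x)
  ...   | no _ = refl

module Factorisation (𝕊 : Sig) (θ : Subst 𝕊) (N : ℕ) (θ-supp : ∀ x → N ≤ x → θ x ≡ var x)
                     (M : ℕ) (fv-θ<M : ∀ k → k < N → ∀ {x} → x ∈ fvT 𝕊 (θ k) → x < M) where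
  open Syntax 𝕊

  fresh : ℕ → ℕ
  fresh k = M + k

  <M⇒≢fresh : ∀ {x} k → x < M → x ≢ fresh k
  <M⇒≢fresh k x<M refl = <-irrefl refl (<-≤-trans x<M (m≤m+n M k))

  shift : Subst 𝕊
  shift x with x <? N
  ... | yes _ = var (fresh x)
  ... | no _ = var x

  shift-finSupp : FinSupp 𝕊 shift
  shift-finSupp = N , shift-id
    where
    shift-id : ∀ x → N ≤ x → shift x ≡ var x
    shift-id x N≤x with x <? N
    ... | yes x<N = ⊥-elim (≤⇒≯ N≤x x<N)
    ... | no _ = refl

  shift-atomic : AtomicSubst 𝕊 shift
  shift-atomic x with x <? N
  ... | yes _ = isVar _
  ... | no _ = isVar _

  step : ℕ → Subst 𝕊
  step k = [_/_,_/_] 𝕊 (θ k) (fresh k) (var (fresh k)) (fresh k)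

  prefix : ℕ → Subst 𝕊
  prefix k x with x <? k
  ... | yes _ = θ x
  ... | no _ = shift x

  afterSteps : ℕ → Form 𝕊 0 → Form 𝕊 0
  afterSteps zero φ = sF 𝕊 shift φ
  afterSteps (suc k) φ = sF 𝕊 (step k) (afterSteps k φ)

  Bounded : Form 𝕊 0 → Set
  Bounded φ = ∀ x → x ∈ fvF 𝕊 φ → x < M

  fresh∉step : ∀ k → k < N → ∀ y {x} → x ∈ fvT 𝕊 (step k y) → x ≢ fresh k
  fresh∉step k k<N y x∈ with y ≟ fresh k
  ... | yes refl = <M⇒≢fresh k (fv-θ<M k k<N x∈)
  ... | no y≢z with y ≟ fresh k
  ...   | yes y≡z = ⊥-elim (y≢z y≡z)
  ...   | no _ with x∈
  ...     | here refl = y≢z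

  step-fixes-θ : ∀ k j → j < N → sT 𝕊 (step k) (θ j) ≡ θ j
  step-fixes-θ k j j<N = trans
    (sT-cong-fv (step k) var (θ j)
      (λ y y∈ → [/,/]-other (θ k) (fresh k) (var (fresh k)) (<M⇒≢fresh k (fv-θ<M j j<N y∈))))
    (sT-var (θ j))

  step⊙prefix : ∀ k x → k < N → x < M → (step k ⊙ prefix k) x ≡ prefix (suc k) x
  step⊙prefix k x k<N x<M with x <? k | x <? suc k
  ... | yes x<k | yes _ = step-fixes-θ k x (<-≤-trans x<k (<⇒≤ k<N))
  ... | yes x<k | no x≮1+k = ⊥-elim (x≮1+k (≤-trans x<k (n≤1+n k)))
  ... | no x≮k | yes x<1+k = step-hits (≤-antisym (≤-pred x<1+k) (≮⇒≥ x≮k))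
    where
    step-hits : x ≡ k → sT 𝕊 (step k) (shift x) ≡ θ x
    step-hits refl with x <? N
    ... | yes _ = trans (cong (wkT 𝕊) ([/,/]-first (θ x) (fresh x) (var (fresh x)) (fresh x))) (wkT-closed (θ x))
    ... | no x≮N = ⊥-elim (x≮N k<N)
  ... | no x≮k | no x≮1+k = step-misses
    where
    step-misses : sT 𝕊 (step k) (shift x) ≡ shift x
    step-misses with x <? N
    ... | yes _ = cong (wkT 𝕊) ([/,/]-other (θ k) (fresh k) (var (fresh k))
                    (λ e → x≮1+k (subst (_< suc k) (sym (+-cancelˡ-≡ M x k e)) (s≤s ≤-refl))))
    ... | no _ = cong (wkT 𝕊) ([/,/]-other (θ k) (fresh k) (var (fresh k)) (<M⇒≢fresh k x<M))

  afterSteps≡prefix : ∀ k → k ≤ N → ∀ φ → Bounded φ → afterSteps k φ ≡ sF 𝕊 (prefix k) φ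
  afterSteps≡prefix zero _ φ bφ = sF-cong-fv shift (prefix zero) φ (λ _ _ → refl)
  afterSteps≡prefix (suc k) k<N φ bφ = begin
    sF 𝕊 (step k) (afterSteps k φ)          ≡⟨ cong (sF 𝕊 (step k)) (afterSteps≡prefix k (<⇒≤ k<N) φ bφ) ⟩
    sF 𝕊 (step k) (sF 𝕊 (prefix k) φ)      ≡⟨ sF-⊙ (step k) (prefix k) φ ⟩
    sF 𝕊 (step k ⊙ prefix k) φ             ≡⟨ sF-cong-fv _ _ φ (λ x x∈ → step⊙prefix k x k<N (bφ x x∈)) ⟩
    sF 𝕊 (prefix (suc k)) φ                ∎
    where open ≡-Reasoning

  prefix-all : ∀ x → prefix N x ≡ θ x
  prefix-all x with x <? N
  ... | yes _ = refl
  ... | no x≮N with x <? N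
  ...   | yes x<N = ⊥-elim (x≮N x<N)
  ...   | no _ = sym (θ-supp x (≮⇒≥ x≮N))

  afterSteps-all : ∀ φ → Bounded φ → afterSteps N φ ≡ sF 𝕊 θ φ
  afterSteps-all φ bφ = trans (afterSteps≡prefix N ≤-refl φ bφ) (sF-cong-fv (prefix N) θ φ (λ x _ → prefix-all x))

module Simulations (𝕊 : Sig) (Φ : List (Production 𝕊)) where

  private
    Tree = PTree 𝕊 Φ
    Fm = Form 𝕊 0

  module _ {A : Set} (E : A → A → Set) (estep : ∀ {a b} → E a b → Fm → Fm → Bool → Set)
           (anteAt : A → List Fm) where

    -- carryᵃ and carryᵇ transport trace formulas of the old structure to the new one
    data StepSim (a b : A) (carryᵃ carryᵇ : Fm → Fm) (rankᵃ rankᵇ : ℕ)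
                 (step′ : Fm → Fm → Bool → Set) : Set where
      matched : (e : E a b) → (∀ C D β → estep e C D β → step′ (carryᵃ C) (carryᵇ D) β)
              → StepSim a b carryᵃ carryᵇ rankᵃ rankᵇ step′
      stutter : a ≡ b → rankᵇ < rankᵃ
              → (∀ D → D ∈ anteAt a → IsIndAtom 𝕊 D → step′ (carryᵃ D) (carryᵇ D) false)
              → StepSim a b carryᵃ carryᵇ rankᵃ rankᵇ step′

  anteOf : (t : Tree) → Addr 𝕊 Φ t → List Fm
  anteOf t a = ante (seqOf 𝕊 Φ (at 𝕊 Φ t a))

  ChildSim : (t : Tree) → Addr 𝕊 Φ t → Addr 𝕊 Φ t → (Fm → Fm) → (Fm → Fm) → ℕ → ℕ
           → (Fm → Fm → Bool → Set) → Set
  ChildSim t = StepSim (Child 𝕊 Φ t) (childStep 𝕊 Φ) (anteOf t)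

  -- A stuttering simulation of t by t′: every edge of t′ either follows an edge of t or
  -- stays put while the rank decreases, and the buds of t′ are exactly the images of those of t.
  record Simulation (t t′ : Tree) : Set where
    field
      proj  : Addr 𝕊 Φ t′ → Addr 𝕊 Φ t
      embed : Addr 𝕊 Φ t → Addr 𝕊 Φ t′
      rank  : Addr 𝕊 Φ t′ → ℕ
      carry : Addr 𝕊 Φ t′ → Fm → Fm
      proj-here  : proj here ≡ here
      rank-here  : rank here ≡ 0
      carry-here : ∀ φ → carry here φ ≡ φ
      seq-here   : seqOf 𝕊 Φ t′ ≡ seqOf 𝕊 Φ t
      child-sim  : ∀ {a b} (c : Child 𝕊 Φ t′ a b)
                 → ChildSim t (proj a) (proj b) (carry a) (carry b) (rank a) (rank b) (childStep 𝕊 Φ c)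
      carry-∈    : ∀ a φ → φ ∈ anteOf t (proj a) → IsIndAtom 𝕊 φ
                 → (carry a φ ∈ anteOf t′ a) × IsIndAtom 𝕊 (carry a φ)
      proj-embed  : ∀ a → proj (embed a) ≡ a
      carry-embed : ∀ a φ → carry (embed a) φ ≡ φ
      seq-embed   : ∀ a → seqOf 𝕊 Φ (at 𝕊 Φ t′ (embed a)) ≡ seqOf 𝕊 Φ (at 𝕊 Φ t a)
      node-embed  : ∀ a → IsNode 𝕊 Φ (at 𝕊 Φ t a) → IsNode 𝕊 Φ (at 𝕊 Φ t′ (embed a))
      bud-embed   : ∀ a′ → IsBud 𝕊 Φ (at 𝕊 Φ t′ a′) → Σ (Addr 𝕊 Φ t) λ a → IsBud 𝕊 Φ (at 𝕊 Φ t a) × (embed a ≡ a′)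

  childSim-there : ∀ {S r ch} p {a b ca cb ra rb step′}
                 → ChildSim (ch p) a b ca cb ra rb step′
                 → ChildSim (node S r ch) (there p a) (there p b) ca cb ra rb step′
  childSim-there p (matched c h) = matched (down p c) h
  childSim-there p (stutter a≡b rank< h) = stutter (cong (there p) a≡b) rank< h

  budSimulation : ∀ S → Simulation (bud S) (bud S)
  budSimulation S = record
    { proj = λ a → a ; embed = λ a → a ; rank = λ _ → 0 ; carry = λ _ φ → φ
    ; proj-here = refl ; rank-here = refl ; carry-here = λ _ → refl ; seq-here = refl
    ; child-sim = λ ()
    ; carry-∈ = λ { here φ φ∈ ind-φ → φ∈ , ind-φ }
    ; proj-embed = λ _ → refl ; carry-embed = λ _ _ → refl ; seq-embed = λ _ → refl
    ; node-embed = λ { here () } ; bud-embed = λ a′ b → a′ , b , refl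
    }

  module _ {S} (r : Inst 𝕊 Φ S) {ch ch′ : Prem 𝕊 Φ r → Tree}
           (sim : ∀ p → Simulation (ch p) (ch′ p)) where
    open module Sim p = Simulation (sim p)

    private
      t  = node S r ch
      t′ = node S r ch′

      projN : Addr 𝕊 Φ t′ → Addr 𝕊 Φ t
      projN here = here
      projN (there p a) = there p (proj p a)

      embedN : Addr 𝕊 Φ t → Addr 𝕊 Φ t′
      embedN here = here
      embedN (there p a) = there p (embed p a)

      rankN : Addr 𝕊 Φ t′ → ℕ
      rankN here = 0
      rankN (there p a) = rank p a

      carryN : Addr 𝕊 Φ t′ → Fm → Fm
      carryN here φ = φ
      carryN (there p a) = carry p a

      top-sim : ∀ p → ChildSim t here (there p (proj p here)) (λ φ → φ) (carry p here) 0 (rank p here) (Step 𝕊 Φ r p)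
      top-sim p rewrite proj-here p =
        matched (top p) (λ C D β st → subst (λ X → Step 𝕊 Φ r p C X β) (sym (carry-here p D)) st)

      child-simN : ∀ {a b} (c : Child 𝕊 Φ t′ a b)
                 → ChildSim t (projN a) (projN b) (carryN a) (carryN b) (rankN a) (rankN b) (childStep 𝕊 Φ c)
      child-simN (top p) = top-sim p
      child-simN (down p c) = childSim-there p (child-sim p c)

      carry-∈N : ∀ a φ → φ ∈ anteOf t (projN a) → IsIndAtom 𝕊 φ → (carryN a φ ∈ anteOf t′ a) × IsIndAtom 𝕊 (carryN a φ)
      carry-∈N here φ φ∈ ind-φ = φ∈ , ind-φ
      carry-∈N (there p a) = carry-∈ p a

      proj-embedN : ∀ a → projN (embedN a) ≡ a
      proj-embedN here = refl
      proj-embedN (there p a) = cong (there p) (proj-embed p a)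

      carry-embedN : ∀ a φ → carryN (embedN a) φ ≡ φ
      carry-embedN here φ = refl
      carry-embedN (there p a) = carry-embed p a

      seq-embedN : ∀ a → seqOf 𝕊 Φ (at 𝕊 Φ t′ (embedN a)) ≡ seqOf 𝕊 Φ (at 𝕊 Φ t a)
      seq-embedN here = refl
      seq-embedN (there p a) = seq-embed p a

      node-embedN : ∀ a → IsNode 𝕊 Φ (at 𝕊 Φ t a) → IsNode 𝕊 Φ (at 𝕊 Φ t′ (embedN a))
      node-embedN here _ = tt
      node-embedN (there p a) = node-embed p a

      bud-embedN : ∀ a′ → IsBud 𝕊 Φ (at 𝕊 Φ t′ a′) → Σ (Addr 𝕊 Φ t) λ a → IsBud 𝕊 Φ (at 𝕊 Φ t a) × (embedN a ≡ a′)
      bud-embedN (there p a′) b with bud-embed p a′ b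
      ... | a , b₀ , refl = there p a , b₀ , refl

    nodeSimulation : Simulation t t′
    nodeSimulation = record
      { proj = projN ; embed = embedN ; rank = rankN ; carry = carryN
      ; proj-here = refl ; rank-here = refl ; carry-here = λ _ → refl ; seq-here = refl
      ; child-sim = child-simN ; carry-∈ = carry-∈N
      ; proj-embed = proj-embedN ; carry-embed = carry-embedN ; seq-embed = seq-embedN
      ; node-embed = node-embedN ; bud-embed = bud-embedN
      }

module TraceTransport (𝕊 : Sig) (Φ : List (Production 𝕊)) where
  open Simulations 𝕊 Φ

  private
    Fm = Form 𝕊 0

  module _ {goal : Seq 𝕊} (pp pp′ : PreProof 𝕊 Φ goal) (gt : GlobalTrace 𝕊 Φ pp)
           (proj  : Addr 𝕊 Φ (PreProof.tree pp′) → Addr 𝕊 Φ (PreProof.tree pp))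
           (rank  : Addr 𝕊 Φ (PreProof.tree pp′) → ℕ)
           (carry : Addr 𝕊 Φ (PreProof.tree pp′) → Fm → Fm)
           (edge-sim : ∀ {a b} (e : Edge 𝕊 Φ pp′ a b)
                     → StepSim (Edge 𝕊 Φ pp) (edgeStep 𝕊 Φ pp) (anteOf (PreProof.tree pp))
                               (proj a) (proj b) (carry a) (carry b) (rank a) (rank b) (edgeStep 𝕊 Φ pp′ e))
           (carry-∈ : ∀ a φ → φ ∈ anteOf (PreProof.tree pp) (proj a) → IsIndAtom 𝕊 φ
                    → (carry a φ ∈ anteOf (PreProof.tree pp′) a) × IsIndAtom 𝕊 (carry a φ))
           where

    module Path (ν′ : ℕ → Addr 𝕊 Φ (PreProof.tree pp′)) (e′ : ∀ n → Edge 𝕊 Φ pp′ (ν′ n) (ν′ (suc n))) where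

      Matched : ℕ → Set
      Matched r = Σ (Edge 𝕊 Φ pp (proj (ν′ r)) (proj (ν′ (suc r)))) λ e →
        ∀ C D β → edgeStep 𝕊 Φ pp e C D β → edgeStep 𝕊 Φ pp′ (e′ r) (carry (ν′ r) C) (carry (ν′ (suc r)) D) β

      Stutters : ℕ → Set
      Stutters q = (proj (ν′ q) ≡ proj (ν′ (suc q)))
        × (∀ D → D ∈ anteOf (PreProof.tree pp) (proj (ν′ q)) → IsIndAtom 𝕊 D
             → edgeStep 𝕊 Φ pp′ (e′ q) (carry (ν′ q) D) (carry (ν′ (suc q)) D) false)

      record NextMatch (k : ℕ) : Set where
        field
          index     : ℕ
          k≤index   : k ≤ index
          matchedAt : Matched index
          stutters  : ∀ q → k ≤ q → q < index → Stutters q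
          same-proj : proj (ν′ k) ≡ proj (ν′ index)
      open NextMatch

      -- stuttering edges strictly decrease the rank, so a matched edge comes after finitely many
      nextMatch-within : ∀ fuel k → rank (ν′ k) < fuel → NextMatch k
      nextMatch-within (suc fuel) k rank<fuel with edge-sim (e′ k)
      ... | matched e h = record
        { index = k ; k≤index = ≤-refl ; matchedAt = e , h
        ; stutters = λ q k≤q q<k → ⊥-elim (<-irrefl refl (<-≤-trans q<k k≤q)) ; same-proj = refl }
      ... | stutter same rank< h = record
        { index = index next ; k≤index = ≤-trans (n≤1+n k) (k≤index next) ; matchedAt = matchedAt next
        ; stutters = stutters′ ; same-proj = trans same (same-proj next) }
        where
        next : NextMatch (suc k)
        next = nextMatch-within fuel (suc k) (<-≤-trans rank< (≤-pred rank<fuel))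
        stutters′ : ∀ q → k ≤ q → q < index next → Stutters q
        stutters′ q k≤q q<i with m≤n⇒m<n∨m≡n k≤q
        ... | inj₁ k<q = stutters next q k<q q<i
        ... | inj₂ refl = same , h

      nextMatch : ∀ k → NextMatch k
      nextMatch k = nextMatch-within (suc (rank (ν′ k))) k ≤-refl

      match : ℕ → ℕ
      match zero = index (nextMatch 0)
      match (suc j) = index (nextMatch (suc (match j)))

      matched-match : ∀ j → Matched (match j)
      matched-match zero = matchedAt (nextMatch 0)
      matched-match (suc j) = matchedAt (nextMatch (suc (match j)))

      oldPath : ℕ → Addr 𝕊 Φ (PreProof.tree pp)
      oldPath j = proj (ν′ (match j))

      oldEdge : ∀ j → Edge 𝕊 Φ pp (oldPath j) (oldPath (suc j))
      oldEdge j = subst (Edge 𝕊 Φ pp (oldPath j)) (same-proj (nextMatch (suc (match j)))) (proj₁ (matched-match j))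

      edgeStep-subst : ∀ {a b b′} (b≡b′ : b ≡ b′) (e : Edge 𝕊 Φ pp a b) {C D β}
                     → edgeStep 𝕊 Φ pp (subst (Edge 𝕊 Φ pp a) b≡b′ e) C D β → edgeStep 𝕊 Φ pp e C D β
      edgeStep-subst refl e st = st

      i₀ : ℕ
      i₀ = proj₁ (gt oldPath oldEdge)

      τ : ℕ → Fm
      τ = proj₁ (proj₂ (gt oldPath oldEdge))

      prog : ℕ → Bool
      prog = proj₁ (proj₂ (proj₂ (gt oldPath oldEdge)))

      τ-∈ : ∀ n → IsIndAtom 𝕊 (τ n) × (τ n ∈ anteOf (PreProof.tree pp) (oldPath (n + i₀)))
      τ-∈ = proj₁ (proj₂ (proj₂ (proj₂ (gt oldPath oldEdge))))

      τ-step : ∀ n → edgeStep 𝕊 Φ pp (oldEdge (n + i₀)) (τ n) (τ (suc n)) (prog n)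
      τ-step = proj₁ (proj₂ (proj₂ (proj₂ (proj₂ (gt oldPath oldEdge)))))

      prog-often : ∀ m → Σ ℕ λ n → (m ≤ n) × (prog n ≡ true)
      prog-often = proj₂ (proj₂ (proj₂ (proj₂ (proj₂ (gt oldPath oldEdge)))))

      -- The new trace starts where the old one does; its n-th formula sits at ν′ (n + s), in the
      -- segment of stuttering edges that ends with the matched edge  end j  of the j-th old step.
      s : ℕ
      s = match i₀

      end : ℕ → ℕ
      end j = match (j + i₀)

      InSegment : ℕ → ℕ → Set
      InSegment n j = (n + s ≤ end j) × (proj (ν′ (n + s)) ≡ oldPath (j + i₀))
                    × (∀ q → n + s ≤ q → q < end j → Stutters q)

      segment-after-end : ∀ n j → n + s ≡ end j → InSegment (suc n) (suc j)
      segment-after-end n j n+s≡end rewrite n+s≡end =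
        k≤index next , same-proj next , stutters next
        where next = nextMatch (suc (end j))

      before-end : ∀ {n} j → n + s ≤ end j → n + s ≢ end j → suc n + s ≤ end j
      before-end j ≤end ≢end with m≤n⇒m<n∨m≡n ≤end
      ... | inj₁ <end = <end
      ... | inj₂ ≡end = ⊥-elim (≢end ≡end)

      advance : ∀ n → Σ ℕ (InSegment n) → Σ ℕ (InSegment (suc n))
      advance n (j , ≤end , at-j , st) with n + s ≟ end j
      ... | yes ≡end = suc j , segment-after-end n j ≡end
      ... | no ≢end = j , before-end j ≤end ≢end
                        , trans (sym (proj₁ (st (n + s) ≤-refl (before-end j ≤end ≢end)))) at-j
                        , λ q le lt → st q (≤-trans (n≤1+n _) le) lt

      segment : ∀ n → Σ ℕ (InSegment n)
      segment zero = 0 , ≤-refl , refl , λ q le lt → ⊥-elim (<-irrefl refl (<-≤-trans lt le))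
      segment (suc n) = advance n (segment n)

      seg : ℕ → ℕ
      seg n = proj₁ (segment n)

      τ′ : ℕ → Fm
      τ′ n = carry (ν′ (n + s)) (τ (seg n))

      progAt : ∀ n → Σ ℕ (InSegment n) → Bool
      progAt n (j , _) with n + s ≟ end j
      ... | yes _ = prog j
      ... | no _ = false

      prog′ : ℕ → Bool
      prog′ n = progAt n (segment n)

      τ′-∈ : ∀ n → IsIndAtom 𝕊 (τ′ n) × (τ′ n ∈ anteOf (PreProof.tree pp′) (ν′ (n + s)))
      τ′-∈ n with segment n
      ... | j , _ , at-j , _ with carry-∈ (ν′ (n + s)) (τ j)
                                   (subst (λ a → τ j ∈ anteOf (PreProof.tree pp) a) (sym at-j) (proj₂ (τ-∈ j)))
                                   (proj₁ (τ-∈ j))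
      ...   | ∈ , atom = atom , ∈

      matched-step : ∀ m j → m ≡ end j
                   → edgeStep 𝕊 Φ pp′ (e′ m) (carry (ν′ m) (τ j)) (carry (ν′ (suc m)) (τ (suc j))) (prog j)
      matched-step .(end j) j refl =
        proj₂ (matched-match (j + i₀)) (τ j) (τ (suc j)) (prog j)
              (edgeStep-subst (same-proj (nextMatch (suc (end j)))) (proj₁ (matched-match (j + i₀))) (τ-step j))

      step-within : ∀ n w → edgeStep 𝕊 Φ pp′ (e′ (n + s)) (carry (ν′ (n + s)) (τ (proj₁ w)))
                                     (carry (ν′ (suc n + s)) (τ (proj₁ (advance n w)))) (progAt n w)
      step-within n (j , ≤end , at-j , st) with n + s ≟ end j
      ... | yes ≡end = matched-step (n + s) j ≡end
      ... | no ≢end = proj₂ (st (n + s) ≤-refl (before-end j ≤end ≢end)) (τ j)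
                        (subst (λ a → τ j ∈ anteOf (PreProof.tree pp) a) (sym at-j) (proj₂ (τ-∈ j)))
                        (proj₁ (τ-∈ j))

      τ′-step : ∀ n → edgeStep 𝕊 Φ pp′ (e′ (n + s)) (τ′ n) (τ′ (suc n)) (prog′ n)
      τ′-step n = step-within n (segment n)

      AtEnd : ℕ → Set
      AtEnd n = n + s ≡ end (seg n)

      prog′-atEnd : ∀ n → AtEnd n → prog′ n ≡ prog (seg n)
      prog′-atEnd n at = lemma (segment n) at
        where
        lemma : ∀ w → n + s ≡ end (proj₁ w) → progAt n w ≡ prog (proj₁ w)
        lemma (j , _) at with n + s ≟ end j
        ... | yes _ = refl
        ... | no ≢end = ⊥-elim (≢end at)

      seg-advance-end : ∀ n → AtEnd n → seg (suc n) ≡ suc (seg n)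
      seg-advance-end n at = lemma (segment n) at
        where
        lemma : ∀ w → n + s ≡ end (proj₁ w) → proj₁ (advance n w) ≡ suc (proj₁ w)
        lemma (j , _) at with n + s ≟ end j
        ... | yes _ = refl
        ... | no ≢end = ⊥-elim (≢end at)

      seg-advance-inner : ∀ n → ¬ AtEnd n → seg (suc n) ≡ seg n
      seg-advance-inner n ¬at = lemma (segment n) ¬at
        where
        lemma : ∀ w → n + s ≢ end (proj₁ w) → proj₁ (advance n w) ≡ proj₁ w
        lemma (j , _) ¬at with n + s ≟ end j
        ... | yes ≡end = ⊥-elim (¬at ≡end)
        ... | no _ = refl

      ReachesEnd : ℕ → ℕ → Set
      ReachesEnd n j = Σ ℕ λ n′ → (n ≤ n′) × (seg n′ ≡ j) × AtEnd n′

      reach-segment-end : ∀ d n → d + (n + s) ≡ end (seg n) → ReachesEnd n (seg n)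
      reach-segment-end zero n at = n , ≤-refl , refl , at
      reach-segment-end (suc d) n d+n+s≡end =
        let n′ , le , seg≡ , at = reach-segment-end d (suc n) d+sn+s≡end
        in n′ , ≤-trans (n≤1+n n) le , trans seg≡ seg-same , at
        where
        seg-same : seg (suc n) ≡ seg n
        seg-same = seg-advance-inner n (λ at → <-irrefl (trans at (sym d+n+s≡end))
                                                     (s≤s (m≤n+m (n + s) d)))
        d+sn+s≡end : d + (suc n + s) ≡ end (seg (suc n))
        d+sn+s≡end = trans (+-suc d (n + s)) (trans d+n+s≡end (cong end (sym seg-same)))

      reach-end : ∀ n → ReachesEnd n (seg n)
      reach-end n = let d , n+s+d≡end = m≤n⇒∃[o]m+o≡n (proj₁ (proj₂ (segment n)))
                    in reach-segment-end d n (trans (+-comm d (n + s)) n+s+d≡end)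

      reach-later : ∀ k n → ReachesEnd n (k + seg n)
      reach-later zero n = reach-end n
      reach-later (suc k) n =
        let n₁ , le₁ , seg₁ , at₁ = reach-later k n
            n₂ , le₂ , seg₂ , at₂ = reach-end (suc n₁)
        in n₂ , ≤-trans le₁ (≤-trans (n≤1+n n₁) le₂)
              , trans seg₂ (trans (seg-advance-end n₁ at₁) (cong suc seg₁)) , at₂

      prog′-often : ∀ m → Σ ℕ λ n → (m ≤ n) × (prog′ n ≡ true)
      prog′-often m =
        let k , seg≤k , prog-k = prog-often (seg m)
            d , seg+d≡k = m≤n⇒∃[o]m+o≡n seg≤k
            n , m≤n , segn≡ , at = reach-later d m
        in n , m≤n , trans (prog′-atEnd n at) (trans (cong prog (trans segn≡ (trans (+-comm d (seg m)) seg+d≡k))) prog-k)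

    transportGlobalTrace : GlobalTrace 𝕊 Φ pp′
    transportGlobalTrace ν′ e′ = s , τ′ , prog′ , τ′-∈ , τ′-step , prog′-often
      where open Path ν′ e′

module SimulatedProof (𝕊 : Sig) (Φ : List (Production 𝕊)) where
  open Simulations 𝕊 Φ
  open TraceTransport 𝕊 Φ

  module _ {goal : Seq 𝕊} (pr : Proof 𝕊 Φ goal) {t′ : PTree 𝕊 Φ}
           (sim : Simulation (PreProof.tree (Proof.preproof pr)) t′) (valid′ : Valid 𝕊 Φ t′) where
    private
      pp = Proof.preproof pr
      t = PreProof.tree pp
    open PreProof pp
    open Simulation sim

    companion′ : (a′ : Addr 𝕊 Φ t′) → IsBud 𝕊 Φ (at 𝕊 Φ t′ a′) → Addr 𝕊 Φ t′
    companion′ a′ b = let a , b₀ , _ = bud-embed a′ b in embed (comp a b₀)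

    companion′-seq : ∀ a′ b → _≈S_ 𝕊 (seqOf 𝕊 Φ (at 𝕊 Φ t′ (companion′ a′ b))) (seqOf 𝕊 Φ (at 𝕊 Φ t′ a′))
    companion′-seq a′ b with bud-embed a′ b
    ... | a , b₀ , refl rewrite seq-embed (comp a b₀) | seq-embed a = compSeq a b₀

    pp′ : PreProof 𝕊 Φ goal
    pp′ = record
      { tree = t′
      ; valid = valid′
      ; rootSeq = subst (λ S → _≈S_ 𝕊 S goal) (sym seq-here) rootSeq
      ; comp = companion′
      ; compNode = λ a′ b → let a , b₀ , _ = bud-embed a′ b in node-embed (comp a b₀) (compNode a b₀)
      ; compSeq = companion′-seq
      }

    edge-sim : ∀ {a b} (e : Edge 𝕊 Φ pp′ a b)
             → StepSim (Edge 𝕊 Φ pp) (edgeStep 𝕊 Φ pp) (anteOf t)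
                       (proj a) (proj b) (carry a) (carry b) (rank a) (rank b) (edgeStep 𝕊 Φ pp′ e)
    edge-sim (child c) with child-sim c
    ... | matched c₀ h = matched (child c₀) h
    ... | stutter same rank< h = stutter same rank< h
    edge-sim {a′} (back b) with bud-embed a′ b
    ... | a , b₀ , refl rewrite proj-embed a | proj-embed (comp a b₀) =
      matched (back b₀) λ C D β (D≡C , β≡false) →
        trans (carry-embed (comp a b₀) D) (trans D≡C (sym (carry-embed a C))) , β≡false

    simulatedProof : Proof 𝕊 Φ goal
    simulatedProof = record
      { preproof = pp′
      ; gtc = transportGlobalTrace pp pp′ (Proof.gtc pr) proj rank carry edge-sim carry-∈
      }

module Gadget (𝕊 : Sig) (Φ : List (Production 𝕊)) where
  open Syntax 𝕊
  open Simulations 𝕊 Φ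

  private
    Fm = Form 𝕊 0
    Tree = PTree 𝕊 Φ

  module _ (S : Seq 𝕊) (θ : Subst 𝕊) (θ-fin : FinSupp 𝕊 θ) (Γ Δ : List Fm)
           (S-ante : ante S ≋ map (sF 𝕊 θ) Γ) (S-succ : succ S ≋ map (sF 𝕊 θ) Δ) where

    N : ℕ
    N = proj₁ θ-fin

    usedVars : List ℕ
    usedVars = fvL 𝕊 Γ ++ fvL 𝕊 Δ ++ concat (applyUpTo (λ k → fvT 𝕊 (θ k)) N)

    M : ℕ
    M = suc (max 0 usedVars)

    used<M : ∀ {x} → x ∈ usedVars → x < M
    used<M x∈ = s≤s (All.lookup (xs≤max 0 usedVars) x∈)

    fv-θ<M : ∀ k → k < N → ∀ {x} → x ∈ fvT 𝕊 (θ k) → x < M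
    fv-θ<M k k<N x∈ = used<M (∈-++⁺ʳ (fvL 𝕊 Γ) (∈-++⁺ʳ (fvL 𝕊 Δ)
                        (∈-concat⁺′ x∈ (∈-applyUpTo⁺ (λ k → fvT 𝕊 (θ k)) k<N))))

    open Factorisation 𝕊 θ N (proj₂ θ-fin) M fv-θ<M

    Γ-bounded : ∀ {φ} → φ ∈ Γ → Bounded φ
    Γ-bounded φ∈ x x∈ = used<M (∈-++⁺ˡ (fvF⊆fvL Γ φ∈ x∈))

    Δ-bounded : ∀ {φ} → φ ∈ Δ → Bounded φ
    Δ-bounded φ∈ x x∈ = used<M (∈-++⁺ʳ (fvL 𝕊 Γ) (∈-++⁺ˡ (fvF⊆fvL Δ φ∈ x∈)))

    anteAt : ℕ → List Fm
    anteAt zero = map (sF 𝕊 shift) Γ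
    anteAt (suc k) = map (sF 𝕊 (step k)) (anteAt k)

    succAt : ℕ → List Fm
    succAt zero = map (sF 𝕊 shift) Δ
    succAt (suc k) = map (sF 𝕊 (step k)) (succAt k)

    afterSteps∈anteAt : ∀ k {φ} → φ ∈ Γ → afterSteps k φ ∈ anteAt k
    afterSteps∈anteAt zero φ∈ = ∈-map⁺ (sF 𝕊 shift) φ∈
    afterSteps∈anteAt (suc k) φ∈ = ∈-map⁺ (sF 𝕊 (step k)) (afterSteps∈anteAt k φ∈)

    afterSteps-indAtom : ∀ k {φ} → IsIndAtom 𝕊 φ → IsIndAtom 𝕊 (afterSteps k φ)
    afterSteps-indAtom zero φ-atom = sF-indAtom shift φ-atom
    afterSteps-indAtom (suc k) φ-atom = sF-indAtom (step k) (afterSteps-indAtom k φ-atom)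

    anteAt≡ : ∀ k → anteAt k ≡ map (afterSteps k) Γ
    anteAt≡ zero = refl
    anteAt≡ (suc k) = trans (cong (map (sF 𝕊 (step k))) (anteAt≡ k)) (sym (map-∘ Γ))

    succAt≡ : ∀ k → succAt k ≡ map (afterSteps k) Δ
    succAt≡ zero = refl
    succAt≡ (suc k) = trans (cong (map (sF 𝕊 (step k))) (succAt≡ k)) (sym (map-∘ Δ))

    S-ante′ : ante S ≋ map (sF 𝕊 var) (anteAt N)
    S-ante′ = ≋-trans S-ante (≋-reflexive (sym (begin
      map (sF 𝕊 var) (anteAt N)   ≡⟨ map-id-local (All.tabulate (λ {φ} _ → sF-var φ)) ⟩
      anteAt N                    ≡⟨ anteAt≡ N ⟩
      map (afterSteps N) Γ        ≡⟨ map-cong-local (All.tabulate (λ φ∈ → afterSteps-all _ (Γ-bounded φ∈))) ⟩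
      map (sF 𝕊 θ) Γ              ∎)))
      where open ≡-Reasoning

    S-succ′ : succ S ≋ map (sF 𝕊 var) (succAt N)
    S-succ′ = ≋-trans S-succ (≋-reflexive (sym (begin
      map (sF 𝕊 var) (succAt N)   ≡⟨ map-id-local (All.tabulate (λ {φ} _ → sF-var φ)) ⟩
      succAt N                    ≡⟨ succAt≡ N ⟩
      map (afterSteps N) Δ        ≡⟨ map-cong-local (All.tabulate (λ φ∈ → afterSteps-all _ (Δ-bounded φ∈))) ⟩
      map (sF 𝕊 θ) Δ              ∎)))
      where open ≡-Reasoning

    witnessBody : ℕ → Form 𝕊 1
    witnessBody k = wkT 𝕊 (θ k) ≐ bv zero

    witness : ℕ → Fm
    witness k = ∃' (witnessBody k)

    fresh∉map-step : ∀ k → k < N → ∀ φs {x} → x ∈ fvL 𝕊 (map (sF 𝕊 (step k)) φs) → x ≢ fresh k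
    fresh∉map-step k k<N φs x∈ = let y , _ , x∈θy = fvL-map-sF⁻ (step k) φs x∈ in fresh∉step k k<N y x∈θy

    fresh∉witnessSequent : ∀ k → k < N → fresh k ∉ fvSeq 𝕊 ((witness k ∷ anteAt (suc k)) ⊢ succAt (suc k))
    fresh∉witnessSequent k k<N z∈ with ∈-++⁻ (fvL 𝕊 (witness k ∷ anteAt (suc k))) z∈
    ... | inj₂ z∈succ = fresh∉map-step k k<N (succAt k) z∈succ refl
    ... | inj₁ z∈ante with ∈-++⁻ (fvF 𝕊 (witness k)) z∈ante
    ...   | inj₂ z∈anteAt = fresh∉map-step k k<N (anteAt k) z∈anteAt refl
    ...   | inj₁ z∈witness with ∈-++⁻ (fvT 𝕊 (wkT 𝕊 {1} (θ k))) z∈witness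
    ...     | inj₁ z∈θk = <M⇒≢fresh k (fv-θ<M k k<N (subst (fresh k ∈_) (fvT-wkT (θ k)) z∈θk)) refl

    reflLeaf : ℕ → Tree
    reflLeaf k = node (anteAt (suc k) ⊢ ((θ k ≐ θ k) ∷ succAt (suc k)))
      (lk (eqR (θ k)) (anteAt (suc k)) (succAt (suc k)) tt ≋-refl ≋-refl) (λ ())

    witnessIntro : ℕ → Tree
    witnessIntro k = node (anteAt (suc k) ⊢ (witness k ∷ succAt (suc k)))
      (lk (exR (witnessBody k) (θ k)) (anteAt (suc k)) (succAt (suc k)) tt ≋-refl ≋-refl) (λ _ → reflLeaf k)

    -- (=L) with t = θ k, u = x = y = fresh k rewrites  anteAt k ⊢ succAt k  to the next stage
    eqLNode : ℕ → Tree → Tree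
    eqLNode k c = node (((θ k ≐ var (fresh k)) ∷ anteAt (suc k)) ⊢ succAt (suc k))
      (eqLI (θ k) (var (fresh k)) (fresh k) (fresh k) (anteAt k) (succAt k) ≋-refl ≋-refl) (λ _ → c)

    witnessElim : ∀ k → k < N → Tree → Tree
    witnessElim k k<N c = node ((witness k ∷ anteAt (suc k)) ⊢ succAt (suc k))
      (lk (exL (witnessBody k) (fresh k)) (anteAt (suc k)) (succAt (suc k)) (fresh∉witnessSequent k k<N) ≋-refl ≋-refl)
      (λ _ → eqLNode k c)

    cutPremises : ∀ k → k < N → Tree → Fin 2 → Tree
    cutPremises k k<N c zero = witnessIntro k
    cutPremises k k<N c (suc _) = witnessElim k k<N c

    stages : ∀ k → k ≤ N → Tree → Tree
    stages zero _ c = node (anteAt zero ⊢ succAt zero) (substI shift shift-finSupp Γ Δ ≋-refl ≋-refl) (λ _ → c)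
    stages (suc k) k<N c = node (anteAt (suc k) ⊢ succAt (suc k))
      (lk (cutR (witness k)) (anteAt (suc k)) (succAt (suc k)) tt ≋-refl ≋-refl)
      (cutPremises k k<N (stages k (<⇒≤ k<N) c))

    witnessIntro-budFree : ∀ k x → ¬ IsBud 𝕊 Φ (at 𝕊 Φ (witnessIntro k) x)
    witnessIntro-budFree k here ()
    witnessIntro-budFree k (there zero here) ()

    gadget : Tree → Tree
    gadget c = node S (substI var (0 , λ _ _ → refl) (anteAt N) (succAt N) S-ante′ S-succ′) (λ _ → stages N ≤-refl c)

    seq-stages : ∀ k k≤N c → seqOf 𝕊 Φ (stages k k≤N c) ≡ (anteAt k ⊢ succAt k)
    seq-stages zero _ c = refl
    seq-stages (suc k) _ c = refl

    stages-atomic : ∀ {c} → AllSubstAtomic 𝕊 Φ c → ∀ k k≤N → AllSubstAtomic 𝕊 Φ (stages k k≤N c)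
    stages-atomic atomic-c zero _ = shift-atomic , λ _ → atomic-c
    stages-atomic atomic-c (suc k) k<N = tt , λ
      { zero → tt , λ _ → tt , λ ()
      ; (suc zero) → tt , λ _ → tt , λ _ → stages-atomic atomic-c k (<⇒≤ k<N) }

    gadget-atomic : ∀ {c} → AllSubstAtomic 𝕊 Φ c → AllSubstAtomic 𝕊 Φ (gadget c)
    gadget-atomic atomic-c = isVar , λ _ → stages-atomic atomic-c N ≤-refl

    module _ {c : Tree} (valid-c : Valid 𝕊 Φ c) (c≈ : _≈S_ 𝕊 (seqOf 𝕊 Φ c) (Γ ⊢ Δ)) where
      private
        drop-eqL : ∀ k (φs : List Fm) → map (sF 𝕊 ([_/_,_/_] 𝕊 (var (fresh k)) (fresh k) (θ k) (fresh k))) φs ≡ φs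
        drop-eqL k φs = map-id-local (All.tabulate (λ {φ} _ → sF-identity _ ([x/x,/x]-identity (fresh k) (θ k)) φ))

      stages-valid : ∀ k k≤N → Valid 𝕊 Φ (stages k k≤N c)
      stages-valid zero _ _ = c≈ , valid-c
      stages-valid (suc k) k<N zero =
        (≋-refl , ≋-refl) , λ _ →
          (≋-refl , ≋-reflexive (cong₂ (λ t u → (t ≐ u) ∷ succAt (suc k)) (sym (oT-wkT (θ k) (θ k))) (sym (wkT-closed (θ k)))))
          , λ ()
      stages-valid (suc k) k<N (suc zero) =
        (≋-refl , ≋-refl) , λ _ →
          (≋-reflexive (cong (λ t → (t ≐ var (fresh k)) ∷ anteAt (suc k)) (sym (oT-wkT (var (fresh k)) (θ k)))) , ≋-refl)
          , λ _ → (≋-reflexive (trans (cong ante (seq-stages k _ c)) (sym (drop-eqL k (anteAt k))))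
                  , ≋-reflexive (trans (cong succ (seq-stages k _ c)) (sym (drop-eqL k (succAt k)))))
                  , stages-valid k (<⇒≤ k<N)

      gadget-valid : Valid 𝕊 Φ (gadget c)
      gadget-valid _ = (≋-reflexive (cong ante (seq-stages N ≤-refl c)) , ≋-reflexive (cong succ (seq-stages N ≤-refl c)))
                     , stages-valid N ≤-refl

    module _ {ch : ⊤ → Tree} {c′ : Tree} (sim : Simulation (ch tt) c′)
             (premise-ante : ∀ {φ} → φ ∈ ante (seqOf 𝕊 Φ (ch tt)) → φ ∈ Γ) where
      open Simulation sim

      private
        t : Tree
        t = node S (substI θ θ-fin Γ Δ S-ante S-succ) ch

        premise : Addr 𝕊 Φ t
        premise = there tt here

      liftS : ∀ k k≤N → Addr 𝕊 Φ c′ → Addr 𝕊 Φ (stages k k≤N c′)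
      liftS zero _ a = there tt a
      liftS (suc k) k<N a = there (suc zero) (there zero (there tt (liftS k (<⇒≤ k<N) a)))

      -- everything outside the continuation c′ simulates the premise of the old (Subst)
      projS : ∀ k k≤N → Addr 𝕊 Φ (stages k k≤N c′) → Addr 𝕊 Φ t
      projS zero _ (there tt a) = there tt (proj a)
      projS (suc k) k<N (there (suc zero) (there zero (there tt x))) = projS k (<⇒≤ k<N) x
      projS _ _ _ = premise

      carryS : ∀ k k≤N → Addr 𝕊 Φ (stages k k≤N c′) → Fm → Fm
      carryS zero _ (there tt a) = carry a
      carryS (suc k) k<N (there (suc zero) (there zero (there tt x))) = carryS k (<⇒≤ k<N) x
      carryS k _ _ = afterSteps k

      stageRank : ℕ → ℕ
      stageRank zero = 1
      stageRank (suc k) = 3 + stageRank k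

      rankS : ∀ k k≤N → Addr 𝕊 Φ (stages k k≤N c′) → ℕ
      rankS zero _ here = 1
      rankS zero _ (there tt a) = rank a
      rankS (suc k) _ here = stageRank (suc k)
      rankS (suc k) _ (there zero here) = 2
      rankS (suc k) _ (there zero (there _ _)) = 1
      rankS (suc k) _ (there (suc zero) here) = 2 + stageRank k
      rankS (suc k) _ (there (suc zero) (there zero here)) = 1 + stageRank k
      rankS (suc k) k<N (there (suc zero) (there zero (there tt x))) = rankS k (<⇒≤ k<N) x

      projS-here : ∀ k k≤N → projS k k≤N here ≡ premise
      projS-here zero _ = refl
      projS-here (suc k) _ = refl

      carryS-here : ∀ k k≤N φ → carryS k k≤N here φ ≡ afterSteps k φ
      carryS-here zero _ φ = refl
      carryS-here (suc k) _ φ = refl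

      rankS-here : ∀ k k≤N → rankS k k≤N here ≡ stageRank k
      rankS-here zero _ = refl
      rankS-here (suc k) _ = refl

      projS-lift : ∀ k k≤N a → projS k k≤N (liftS k k≤N a) ≡ there tt (proj a)
      projS-lift zero _ a = refl
      projS-lift (suc k) k<N a = projS-lift k (<⇒≤ k<N) a

      carryS-lift : ∀ k k≤N a φ → carryS k k≤N (liftS k k≤N a) φ ≡ carry a φ
      carryS-lift zero _ a φ = refl
      carryS-lift (suc k) k<N a φ = carryS-lift k (<⇒≤ k<N) a φ

      at-liftS : ∀ k k≤N a → at 𝕊 Φ (stages k k≤N c′) (liftS k k≤N a) ≡ at 𝕊 Φ c′ a
      at-liftS zero _ a = refl
      at-liftS (suc k) k<N a = at-liftS k (<⇒≤ k<N) a

      bud-stages : ∀ k k≤N x → IsBud 𝕊 Φ (at 𝕊 Φ (stages k k≤N c′) x)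
                 → Σ (Addr 𝕊 Φ c′) λ a → IsBud 𝕊 Φ (at 𝕊 Φ c′ a) × (liftS k k≤N a ≡ x)
      bud-stages zero _ (there tt a) b = a , b , refl
      bud-stages (suc k) _ (there zero x) b = ⊥-elim (witnessIntro-budFree k x b)
      bud-stages (suc k) k<N (there (suc zero) (there zero (there tt x))) b with bud-stages k (<⇒≤ k<N) x b
      ... | a , b′ , refl = a , b′ , refl

      private
        stays : ∀ k D → D ∈ anteOf t premise → IsIndAtom 𝕊 D
              → (afterSteps (suc k) D ∈ anteAt (suc k)) × (afterSteps (suc k) D ≡ afterSteps (suc k) D) × (false ≡ false)
        stays k D D∈ _ = afterSteps∈anteAt (suc k) (premise-ante D∈) , refl , refl

        into-continuation : ChildSim t premise (there tt (proj here)) (afterSteps 0) (carry here) 1 (rank here)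
                              (Step 𝕊 Φ (substI shift shift-finSupp Γ Δ ≋-refl ≋-refl) tt)
        into-continuation rewrite proj-here | rank-here =
          stutter refl (s≤s z≤n) λ D D∈ _ →
            subst (_∈ Γ) (sym (carry-here D)) (premise-ante D∈) , cong (sF 𝕊 shift) (sym (carry-here D)) , refl

        into-next-stage : ∀ k k≤N → ChildSim t premise (projS k k≤N here) (afterSteps (suc k)) (carryS k k≤N here)
                            (1 + stageRank k) (rankS k k≤N here)
                            (Step 𝕊 Φ (eqLI (θ k) (var (fresh k)) (fresh k) (fresh k) (anteAt k) (succAt k) ≋-refl ≋-refl) tt)
        into-next-stage k k≤N rewrite projS-here k k≤N | rankS-here k k≤N =
          stutter refl ≤-refl λ D D∈ _ →
            afterSteps k D , afterSteps∈anteAt k (premise-ante D∈) , refl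
            , trans (carryS-here k k≤N D) (sym (sF-identity _ ([x/x,/x]-identity (fresh k) (θ k)) (afterSteps k D)))
            , refl

      stage-sim : ∀ k k≤N {x y} (e : Child 𝕊 Φ (stages k k≤N c′) x y)
                → ChildSim t (projS k k≤N x) (projS k k≤N y) (carryS k k≤N x) (carryS k k≤N y)
                           (rankS k k≤N x) (rankS k k≤N y) (childStep 𝕊 Φ e)
      stage-sim zero _ (top tt) = into-continuation
      stage-sim zero _ (down tt e) = childSim-there tt (child-sim e)
      stage-sim (suc k) _ (top zero) = stutter refl (s≤s (s≤s (s≤s z≤n))) (stays k)
      stage-sim (suc k) _ (top (suc zero)) = stutter refl ≤-refl (stays k)
      stage-sim (suc k) _ (down zero (top zero)) = stutter refl ≤-refl (stays k)
      stage-sim (suc k) _ (down zero (down zero (top ())))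
      stage-sim (suc k) _ (down zero (down zero (down () _)))
      stage-sim (suc k) _ (down (suc zero) (top zero)) = stutter refl ≤-refl (stays k)
      stage-sim (suc k) k<N (down (suc zero) (down zero (top tt))) = into-next-stage k (<⇒≤ k<N)
      stage-sim (suc k) k<N (down (suc zero) (down zero (down tt e))) = stage-sim k (<⇒≤ k<N) e

      stage-carry-∈ : ∀ k k≤N x φ → φ ∈ anteOf t (projS k k≤N x) → IsIndAtom 𝕊 φ
                    → (carryS k k≤N x φ ∈ anteOf (stages k k≤N c′) x) × IsIndAtom 𝕊 (carryS k k≤N x φ)
      stage-carry-∈ zero _ here φ φ∈ atom = afterSteps∈anteAt zero (premise-ante φ∈) , afterSteps-indAtom zero atom
      stage-carry-∈ zero _ (there tt a) = carry-∈ a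
      stage-carry-∈ (suc k) _ here φ φ∈ atom =
        afterSteps∈anteAt (suc k) (premise-ante φ∈) , afterSteps-indAtom (suc k) atom
      stage-carry-∈ (suc k) _ (there zero here) φ φ∈ atom =
        afterSteps∈anteAt (suc k) (premise-ante φ∈) , afterSteps-indAtom (suc k) atom
      stage-carry-∈ (suc k) _ (there zero (there zero here)) φ φ∈ atom =
        afterSteps∈anteAt (suc k) (premise-ante φ∈) , afterSteps-indAtom (suc k) atom
      stage-carry-∈ (suc k) _ (there (suc zero) here) φ φ∈ atom =
        there (afterSteps∈anteAt (suc k) (premise-ante φ∈)) , afterSteps-indAtom (suc k) atom
      stage-carry-∈ (suc k) _ (there (suc zero) (there zero here)) φ φ∈ atom =
        there (afterSteps∈anteAt (suc k) (premise-ante φ∈)) , afterSteps-indAtom (suc k) atom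
      stage-carry-∈ (suc k) k<N (there (suc zero) (there zero (there tt x))) = stage-carry-∈ k (<⇒≤ k<N) x

      private
        t′ : Tree
        t′ = gadget c′

        projG : Addr 𝕊 Φ t′ → Addr 𝕊 Φ t
        projG here = here
        projG (there tt x) = projS N ≤-refl x

        embedG : Addr 𝕊 Φ t → Addr 𝕊 Φ t′
        embedG here = here
        embedG (there tt a) = there tt (liftS N ≤-refl (embed a))

        rankG : Addr 𝕊 Φ t′ → ℕ
        rankG here = 0
        rankG (there tt x) = rankS N ≤-refl x

        carryG : Addr 𝕊 Φ t′ → Fm → Fm
        carryG here φ = φ
        carryG (there tt x) = carryS N ≤-refl x

        root-sim : ChildSim t here (projS N ≤-refl here) (λ φ → φ) (carryS N ≤-refl here) 0 (rankS N ≤-refl here)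
                     (Step 𝕊 Φ (substI var (0 , λ _ _ → refl) (anteAt N) (succAt N) S-ante′ S-succ′) tt)
        root-sim rewrite projS-here N ≤-refl = matched (top tt) λ C D β (D∈Γ , C≡θD , β≡false) →
          subst (_∈ anteAt N) (sym (carryS-here N ≤-refl D)) (afterSteps∈anteAt N D∈Γ)
          , trans C≡θD (trans (sym (afterSteps-all D (Γ-bounded D∈Γ)))
                              (trans (sym (carryS-here N ≤-refl D)) (sym (sF-var _))))
          , β≡false

        child-simG : ∀ {a b} (e : Child 𝕊 Φ t′ a b)
                   → ChildSim t (projG a) (projG b) (carryG a) (carryG b) (rankG a) (rankG b) (childStep 𝕊 Φ e)
        child-simG (top tt) = root-sim
        child-simG (down tt e) = stage-sim N ≤-refl e

        carry-∈G : ∀ a φ → φ ∈ anteOf t (projG a) → IsIndAtom 𝕊 φ → (carryG a φ ∈ anteOf t′ a) × IsIndAtom 𝕊 (carryG a φ)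
        carry-∈G here φ φ∈ atom = φ∈ , atom
        carry-∈G (there tt x) = stage-carry-∈ N ≤-refl x

        proj-embedG : ∀ a → projG (embedG a) ≡ a
        proj-embedG here = refl
        proj-embedG (there tt a) = trans (projS-lift N ≤-refl (embed a)) (cong (there tt) (proj-embed a))

        carry-embedG : ∀ a φ → carryG (embedG a) φ ≡ φ
        carry-embedG here φ = refl
        carry-embedG (there tt a) φ = trans (carryS-lift N ≤-refl (embed a) φ) (carry-embed a φ)

        seq-embedG : ∀ a → seqOf 𝕊 Φ (at 𝕊 Φ t′ (embedG a)) ≡ seqOf 𝕊 Φ (at 𝕊 Φ t a)
        seq-embedG here = refl
        seq-embedG (there tt a) = trans (cong (seqOf 𝕊 Φ) (at-liftS N ≤-refl (embed a))) (seq-embed a)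

        node-embedG : ∀ a → IsNode 𝕊 Φ (at 𝕊 Φ t a) → IsNode 𝕊 Φ (at 𝕊 Φ t′ (embedG a))
        node-embedG here _ = tt
        node-embedG (there tt a) nd = subst (IsNode 𝕊 Φ) (sym (at-liftS N ≤-refl (embed a))) (node-embed a nd)

        bud-embedG : ∀ a′ → IsBud 𝕊 Φ (at 𝕊 Φ t′ a′) → Σ (Addr 𝕊 Φ t) λ a → IsBud 𝕊 Φ (at 𝕊 Φ t a) × (embedG a ≡ a′)
        bud-embedG (there tt x) b =
          let a′ , b′ , lift≡x = bud-stages N ≤-refl x b
              a , b₀ , embed≡a′ = bud-embed a′ b′
          in there tt a , b₀ , cong (there tt) (trans (cong (liftS N ≤-refl) embed≡a′) lift≡x)

      gadgetSimulation : Simulation t t′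
      gadgetSimulation = record
        { proj = projG ; embed = embedG ; rank = rankG ; carry = carryG
        ; proj-here = refl ; rank-here = refl ; carry-here = λ _ → refl ; seq-here = refl
        ; child-sim = child-simG ; carry-∈ = carry-∈G
        ; proj-embed = proj-embedG ; carry-embed = carry-embedG ; seq-embed = seq-embedG
        ; node-embed = node-embedG ; bud-embed = bud-embedG
        }

module Atomisation (𝕊 : Sig) (Φ : List (Production 𝕊)) where
  open Simulations 𝕊 Φ
  open Gadget 𝕊 Φ

  private
    Tree = PTree 𝕊 Φ

  data SubstView {S : Seq 𝕊} : Inst 𝕊 Φ S → Set where
    isSubst : ∀ θ θ-fin Γ Δ S-ante S-succ → SubstView (substI θ θ-fin Γ Δ S-ante S-succ)
    other   : ∀ {r} → substAtomic 𝕊 Φ r → SubstView r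

  substView : ∀ {S} (r : Inst 𝕊 Φ S) → SubstView r
  substView (lk _ _ _ _ _ _) = other tt
  substView (substI θ θ-fin Γ Δ S-ante S-succ) = isSubst θ θ-fin Γ Δ S-ante S-succ
  substView (eqLI _ _ _ _ _ _ _ _) = other tt
  substView (ulI _ _ _ _ _ _ _ _) = other tt

  record Atomised (t : Tree) : Set where
    field
      tree′      : Tree
      simulation : Simulation t tree′
      valid′     : Valid 𝕊 Φ tree′
      atomic     : AllSubstAtomic 𝕊 Φ tree′
  open Atomised

  seq-atomised : ∀ {t} (a : Atomised t) → seqOf 𝕊 Φ (tree′ a) ≡ seqOf 𝕊 Φ t
  seq-atomised a = Simulation.seq-here (simulation a)

  atomise : (t : Tree) → Valid 𝕊 Φ t → Atomised t
  atomise (bud S) _ = record { tree′ = bud S ; simulation = budSimulation S ; valid′ = tt ; atomic = tt }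
  atomise (node S r ch) valid with substView r
  ... | isSubst θ θ-fin Γ Δ S-ante S-succ = record
    { tree′ = gadget S θ θ-fin Γ Δ S-ante S-succ (tree′ c)
    ; simulation = gadgetSimulation S θ θ-fin Γ Δ S-ante S-succ (simulation c) (proj₁ (proj₁ (proj₁ (valid tt))))
    ; valid′ = gadget-valid S θ θ-fin Γ Δ S-ante S-succ (valid′ c)
                 (subst (λ S′ → _≈S_ 𝕊 S′ (Γ ⊢ Δ)) (sym (seq-atomised c)) (proj₁ (valid tt)))
    ; atomic = gadget-atomic S θ θ-fin Γ Δ S-ante S-succ (atomic c)
    }
    where c = atomise (ch tt) (proj₂ (valid tt))
  ... | other r-atomic = record
    { tree′ = node S r (λ p → tree′ (c p))
    ; simulation = nodeSimulation r (λ p → simulation (c p))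
    ; valid′ = λ p → subst (λ S′ → _≈S_ 𝕊 S′ (premSeq 𝕊 Φ r p)) (sym (seq-atomised (c p))) (proj₁ (valid p)) , valid′ (c p)
    ; atomic = r-atomic , λ p → atomic (c p)
    }
    where c = λ p → atomise (ch p) (proj₂ (valid p))

lemma1 : (𝕊 : Sig) (Φ : List (Production 𝕊)) (Γ Δ : List (Form 𝕊 0))
         (pr : Proof 𝕊 Φ (_⊢_ Γ Δ))
       → Σ (Proof 𝕊 Φ (_⊢_ Γ Δ)) (λ pr′ → AtomicSubstProof 𝕊 Φ pr′)
lemma1 𝕊 Φ Γ Δ pr = SimulatedProof.simulatedProof 𝕊 Φ pr (simulation a) (valid′ a) , atomic a
  where
  open Atomisation 𝕊 Φ
  open Atomised
  a = atomise (PreProof.tree (Proof.preproof pr)) (PreProof.valid (Proof.preproof pr))
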